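{- Let $n\ge2$ and $1\le m\le n-1$ be integers. Consider the Markov chain on $\{ -,+\}^m$ which, from the current sign vector $x$, picks $i\in[n]$ uniformly at random and: if $1\le i\le m$, switches the $i$th coordinate of $x$ to $+$; if $m+1\le i<n$, leaves $x$ unchanged; if $i=n$, switches all coordinates of $x$ to $-$. Let $K^*$ be its transition matrix. (i) $K^*$ is diagonalizable with eigenvalue $1$ of multiplicity one and eigenvalues $\frac{n-j-1}{n}$ with multiplicity $\binom{m}{j}$ for $1\le j\le m$. (ii) The stationary distribution of $K^*$ is $\bar\pi(x)=\frac{1}{(m+1)\binom{m}{k}}$ for $x\in\{ -,+\}^m$, where $k$ is the number of coordinates of $x$ equal to $+$. (iii) Assume $m=n-1$ and let $(K^*_x)^l$ be the distribution of the chain started at $x$ after $l$ steps. Then $\|(K^*_x)^l-\bar\pi\|_{\mathrm{TV}}\le(1-\frac1n)^l\le e^{ -c}$ for $l\ge cn$ and $c>0$. Moreover, this bound is sharp, in the sense that there exists $0<\theta<1$ such that $\|(K^*_x)^n-\bar\pi\|_{\mathrm{TV}}\ge\theta$ for all large $n$.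
   Context: Equivalently, this chain records, for the random-to-top chain on permutations of $[n]$ (at each step an entry chosen uniformly at random is moved to the front), the set of $i\in[m]$ appearing before $n$, with coordinate $i$ equal to $+$ iff $i$ precedes $n$. $\|P-Q\|_{\mathrm{TV}}=\max_A|P(A)-Q(A)|$. -}

module Defs where

open import Data.Bool using (Bool; true; false; if_then_else_)
import Data.Bool.Properties as BP
open import Data.Nat as ℕ using (ℕ; zero; suc; _∸_; _<?_)
import Data.Nat.Properties as NP
open import Data.Nat.Combinatorics using (_C_)
open import Data.Fin using (Fin; fromℕ<)
open import Data.Vec using (Vec; []; _∷_; replicate; updateAt)
open import Data.Vec.Properties using (≡-dec)
open import Data.List using (List; []; _∷_; _++_; map; filter; length; upTo; foldr)
open import Data.Integer using (+_)
open import Data.Rational using (ℚ; 0ℚ; 1ℚ; _+_; _*_; _-_; _/_; ∣_∣; _⊔_)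
import Data.Rational.Properties as QP
open import Relation.Nullary using (yes; no; Dec; does)
open import Relation.Binary.PropositionalEquality using (_≡_)

-- Sign vectors in {-,+}^m : Vec Bool m, with true = '+', false = '-'.
-- Coordinate i of the paper (1 ≤ i ≤ m) is position i-1 (0-based).
Sign : ℕ → Set
Sign m = Vec Bool m

_≟v_ : ∀ {m} (x y : Sign m) → Dec (x ≡ y)
_≟v_ = ≡-dec BP._≟_

states : (m : ℕ) → List (Sign m)
states zero    = [] ∷ []
states (suc m) = map (true ∷_) (states m) ++ map (false ∷_) (states m)

-- a / b as a rational (b = 0 never used; returns 0 in that case).
frac : ℕ → ℕ → ℚ
frac a zero    = 0ℚ
frac a (suc b) = (+ a) / suc b

-- Effect of drawing i (0-based, i ∈ {0,…,n-1}, i.e. paper index i+1):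
--   i < m       : switch coordinate i to '+'
--   i = n-1     : switch all coordinates to '-'
--   otherwise   : unchanged
step : (n m : ℕ) → ℕ → Sign m → Sign m
step n m i x with i <? m
... | yes i<m = updateAt x (fromℕ< i<m) (λ _ → true)
... | no _ with i ℕ.≟ (n ∸ 1)
...   | yes _ = replicate m false
...   | no _  = x

Mat : ℕ → Set
Mat m = Sign m → Sign m → ℚ

Kstar : (n m : ℕ) → Mat m
Kstar n m x y = frac (length (filter (λ i → step n m i x ≟v y) (upTo n))) n

Σ[_]_ : ∀ {A : Set} → List A → (A → ℚ) → ℚ
Σ[ xs ] f = foldr (λ a s → f a + s) 0ℚ xs

_⊗_ : ∀ {m} → Mat m → Mat m → Mat m
_⊗_ {m} A B x y = Σ[ states m ] (λ z → A x z * B z y)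

Id : ∀ {m} → Mat m
Id x y = if does (x ≟v y) then 1ℚ else 0ℚ

diag : ∀ {m} → (Sign m → ℚ) → Mat m
diag d x y = if does (x ≟v y) then d x else 0ℚ

_^[_] : ∀ {m} → Mat m → ℕ → Mat m
A ^[ zero ]  = Id
A ^[ suc l ] = (A ^[ l ]) ⊗ A

mult : ∀ m → (Sign m → ℚ) → ℚ → ℕ
mult m d q = length (filter (λ s → d s QP.≟ q) (states m))

numPlus : ∀ {m} → Sign m → ℕ
numPlus []          = zero
numPlus (true ∷ x)  = suc (numPlus x)
numPlus (false ∷ x) = numPlus x

πbar : (m : ℕ) → Sign m → ℚ
πbar m x = frac 1 (suc m ℕ.* (m C numPlus x))

subsets : ∀ {A : Set} → List A → List (List A)
subsets []       = [] ∷ []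
subsets (a ∷ as) = map (a ∷_) (subsets as) ++ subsets as

maxList : List ℚ → ℚ
maxList = foldr _⊔_ 0ℚ

TV : ∀ m → (Sign m → ℚ) → (Sign m → ℚ) → ℚ
TV m P Q = maxList (map (λ A → ∣ Σ[ A ] P - Σ[ A ] Q ∣) (subsets (states m)))

_^ℚ_ : ℚ → ℕ → ℚ
q ^ℚ zero  = 1ℚ
q ^ℚ suc l = q * (q ^ℚ l)

module Submission where

-- Let G T S = 1 when no coordinate is + in both T and S. In one step the event
-- "no + inside the support of S" is destroyed by the |S| draws in that support,
-- restored by the reset draw n and left alone by the others, so
-- K* G_S = ((n − |S| − 1)/n) G_S + 1/n. Hence P_S = G_S − 1/(|S| + 1) (and P_S = 1 for
-- S = −⋯−) is an eigenvector for (n − |S| − 1)/n, and P is G times a rank-one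
-- perturbation of the identity, hence invertible. In the coordinates μ P of a stationary
-- μ only the eigenvalue 1 survives, which forces μ = π̄.
-- When m = n − 1 there are no idle draws; the reset moves μ and π̄ alike, and each of the
-- n − 1 switching draws pulls a set back to a set, so one step shrinks the total variation
-- distance by the factor 1 − 1/n. For S = +−⋯− the eigenvector is ±1/2 according to the
-- first coordinate, so at time n the probability that the first coordinate is − is off by
-- (1 − 2/n)^n / 2 ≥ 1/512 once n ≥ 6.

open import Defs
open import Data.Bool using (Bool; true; false; if_then_else_; _∧_)
import Data.Bool.Properties as BP
open import Data.Empty using (⊥-elim)
open import Data.Fin using (Fin; zero; suc; toℕ; fromℕ<)
import Data.Fin.Properties as FP
open import Data.Integer as ℤ using ()
import Data.Integer.Properties as ℤP
open import Data.List using (List; []; _∷_; _++_; map; length; filter; upTo; applyUpTo)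
open import Data.List.Membership.Propositional using (_∈_)
open import Data.List.Membership.Propositional.Properties using (∈-map⁺; ∈-map⁻; ∈-++⁺ˡ; ∈-++⁺ʳ; ∈-++⁻)
import Data.List.Properties as LP
open import Data.List.Relation.Unary.Any using (here; there)
open import Data.Nat as ℕ using (ℕ; zero; suc; _∸_; _<?_; z≤n; s≤s)
open import Data.Nat.Combinatorics using (_C_; nCk+nC[k+1]≡[n+1]C[k+1]; nC1≡n; k>n⇒nCk≡0)
import Data.Nat.Properties as ℕP
open import Data.Product using (Σ; ∃; _×_; _,_; proj₁; proj₂)
open import Data.Rational as Q using (ℚ; 0ℚ; 1ℚ; _+_; _*_; _-_; -_; 1/_; ∣_∣; toℚᵘ)
import Data.Rational.Properties as QP
open import Data.Rational.Solver using (module +-*-Solver)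
open import Data.Rational.Unnormalised as ℚᵘ using (mkℚᵘ; *≡*)
import Data.Rational.Unnormalised.Properties as ℚᵘP
open import Data.Sum using (_⊎_; inj₁; inj₂)
open import Data.Unit using (tt)
open import Data.Vec using ([]; _∷_; replicate; updateAt; lookup)
open import Relation.Binary.PropositionalEquality
open import Relation.Nullary using (Dec; yes; no; does)
open import Relation.Nullary.Decidable using (toWitness)
open +-*-Solver

fromℕ : ℕ → ℚ
fromℕ a = frac a 1

private
  toℚᵘ-frac : ∀ a b → toℚᵘ (frac a (suc b)) ℚᵘ.≃ mkℚᵘ (ℤ.+ a) b
  toℚᵘ-frac a b = QP.toℚᵘ-fromℚᵘ (mkℚᵘ (ℤ.+ a) b)

fromℕ-+ : ∀ a b → fromℕ (a ℕ.+ b) ≡ fromℕ a + fromℕ b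
fromℕ-+ a b = QP.toℚᵘ-injective (ℚᵘP.≃-trans (toℚᵘ-frac (a ℕ.+ b) 0)
  (ℚᵘP.≃-trans +-≃ (ℚᵘP.≃-sym (ℚᵘP.≃-trans (QP.toℚᵘ-homo-+ (fromℕ a) (fromℕ b))
     (ℚᵘP.+-cong (toℚᵘ-frac a 0) (toℚᵘ-frac b 0))))))
  where
  +-≃ : mkℚᵘ (ℤ.+ (a ℕ.+ b)) 0 ℚᵘ.≃ (mkℚᵘ (ℤ.+ a) 0 ℚᵘ.+ mkℚᵘ (ℤ.+ b) 0)
  +-≃ = *≡* (begin
     ℤ.+ (a ℕ.+ b) ℤ.* ℤ.+ 1                  ≡⟨ ℤP.*-identityʳ _ ⟩
     ℤ.+ (a ℕ.+ b)                            ≡⟨ ℤP.pos-+ a b ⟩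
     ℤ.+ a ℤ.+ ℤ.+ b                          ≡⟨ cong₂ ℤ._+_ (ℤP.*-identityʳ (ℤ.+ a)) (ℤP.*-identityʳ (ℤ.+ b)) ⟨
     ℤ.+ a ℤ.* ℤ.+ 1 ℤ.+ ℤ.+ b ℤ.* ℤ.+ 1      ≡⟨ ℤP.*-identityʳ _ ⟨
     (ℤ.+ a ℤ.* ℤ.+ 1 ℤ.+ ℤ.+ b ℤ.* ℤ.+ 1) ℤ.* ℤ.+ 1 ∎)
    where open ≡-Reasoning

fromℕ-* : ∀ a b → fromℕ (a ℕ.* b) ≡ fromℕ a * fromℕ b
fromℕ-* a b = QP.toℚᵘ-injective (ℚᵘP.≃-trans (toℚᵘ-frac (a ℕ.* b) 0)
  (ℚᵘP.≃-trans (*≡* (cong (ℤ._* ℤ.+ 1) (ℤP.pos-* a b)))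
  (ℚᵘP.≃-sym (ℚᵘP.≃-trans (QP.toℚᵘ-homo-* (fromℕ a) (fromℕ b))
     (ℚᵘP.*-cong (toℚᵘ-frac a 0) (toℚᵘ-frac b 0))))))

fromℕ-suc : ∀ a → fromℕ (suc a) ≡ 1ℚ + fromℕ a
fromℕ-suc = fromℕ-+ 1

fromℕ-injective : ∀ {a b} → fromℕ a ≡ fromℕ b → a ≡ b
fromℕ-injective {a} {b} eq
  with ℚᵘP.≃-trans (ℚᵘP.≃-sym (toℚᵘ-frac a 0)) (ℚᵘP.≃-trans (QP.toℚᵘ-cong eq) (toℚᵘ-frac b 0))
... | *≡* e = ℤP.+-injective (trans (sym (ℤP.*-identityʳ (ℤ.+ a))) (trans e (ℤP.*-identityʳ (ℤ.+ b))))

frac*fromℕ : ∀ a b → frac a (suc b) * fromℕ (suc b) ≡ fromℕ a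
frac*fromℕ a b = QP.toℚᵘ-injective (ℚᵘP.≃-trans (QP.toℚᵘ-homo-* (frac a (suc b)) (fromℕ (suc b)))
  (ℚᵘP.≃-trans (ℚᵘP.*-cong (toℚᵘ-frac a b) (toℚᵘ-frac (suc b) 0))
  (ℚᵘP.≃-trans cancel (ℚᵘP.≃-sym (toℚᵘ-frac a 0)))))
  where
  cancel : (mkℚᵘ (ℤ.+ a) b ℚᵘ.* mkℚᵘ (ℤ.+ suc b) 0) ℚᵘ.≃ mkℚᵘ (ℤ.+ a) 0
  cancel = *≡* (trans (ℤP.*-identityʳ _) (cong (λ z → ℤ.+ a ℤ.* ℤ.+ z) (sym (ℕP.*-identityʳ (suc b)))))

frac≡fromℕ*frac1 : ∀ a n → frac a n ≡ fromℕ a * frac 1 n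
frac≡fromℕ*frac1 a zero    = sym (QP.*-zeroʳ (fromℕ a))
frac≡fromℕ*frac1 a (suc b) = begin
    frac a (suc b)                                       ≡⟨ QP.*-identityʳ _ ⟨
    frac a (suc b) * 1ℚ                                  ≡⟨ cong (frac a (suc b) *_) (frac*fromℕ 1 b) ⟨
    frac a (suc b) * (frac 1 (suc b) * fromℕ (suc b))    ≡⟨ solve 3 (λ x y z → x :* (y :* z) := (x :* z) :* y) refl
                                                              (frac a (suc b)) (frac 1 (suc b)) (fromℕ (suc b)) ⟩
    (frac a (suc b) * fromℕ (suc b)) * frac 1 (suc b)    ≡⟨ cong (_* frac 1 (suc b)) (frac*fromℕ a b) ⟩
    fromℕ a * frac 1 (suc b)                             ∎
  where open ≡-Reasoning

-- Finite sums

module _ {A : Set} where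

  Σ-++ : ∀ (xs ys : List A) f → Σ[ xs ++ ys ] f ≡ Σ[ xs ] f + Σ[ ys ] f
  Σ-++ []       ys f = sym (QP.+-identityˡ _)
  Σ-++ (x ∷ xs) ys f = trans (cong (f x +_) (Σ-++ xs ys f)) (sym (QP.+-assoc (f x) _ _))

  Σ-cong : ∀ (xs : List A) {f g} → (∀ x → f x ≡ g x) → Σ[ xs ] f ≡ Σ[ xs ] g
  Σ-cong []       e = refl
  Σ-cong (x ∷ xs) e = cong₂ _+_ (e x) (Σ-cong xs e)

  Σ-+ : ∀ (xs : List A) f g → Σ[ xs ] (λ x → f x + g x) ≡ Σ[ xs ] f + Σ[ xs ] g
  Σ-+ []       f g = refl
  Σ-+ (x ∷ xs) f g = trans (cong ((f x + g x) +_) (Σ-+ xs f g))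
    (solve 4 (λ a b c d → (a :+ b) :+ (c :+ d) := (a :+ c) :+ (b :+ d)) refl (f x) (g x) _ _)

  Σ-*ˡ : ∀ (xs : List A) c f → Σ[ xs ] (λ x → c * f x) ≡ c * Σ[ xs ] f
  Σ-*ˡ []       c f = sym (QP.*-zeroʳ c)
  Σ-*ˡ (x ∷ xs) c f = trans (cong (c * f x +_) (Σ-*ˡ xs c f)) (sym (QP.*-distribˡ-+ c (f x) _))

  Σ-*ʳ : ∀ (xs : List A) c f → Σ[ xs ] (λ x → f x * c) ≡ Σ[ xs ] f * c
  Σ-*ʳ xs c f = trans (Σ-cong xs (λ x → QP.*-comm (f x) c)) (trans (Σ-*ˡ xs c f) (QP.*-comm c _))

  Σ-0 : ∀ (xs : List A) → Σ[ xs ] (λ _ → 0ℚ) ≡ 0ℚ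
  Σ-0 []       = refl
  Σ-0 (x ∷ xs) = trans (QP.+-identityˡ _) (Σ-0 xs)

  Σ-*0 : ∀ (xs : List A) (f : A → ℚ) → Σ[ xs ] (λ x → f x * 0ℚ) ≡ 0ℚ
  Σ-*0 xs f = trans (Σ-cong xs (λ x → QP.*-zeroʳ (f x))) (Σ-0 xs)

  Σ-neg : ∀ (xs : List A) f → Σ[ xs ] (λ x → - f x) ≡ - Σ[ xs ] f
  Σ-neg []       f = refl
  Σ-neg (x ∷ xs) f = trans (cong (- f x +_) (Σ-neg xs f)) (sym (QP.neg-distrib-+ (f x) _))

  Σ-minus : ∀ (xs : List A) f g → Σ[ xs ] (λ x → f x - g x) ≡ Σ[ xs ] f - Σ[ xs ] g
  Σ-minus xs f g = trans (Σ-+ xs f (λ x → - g x)) (cong (Σ[ xs ] f +_) (Σ-neg xs g))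

  Σ-const : ∀ (xs : List A) c → Σ[ xs ] (λ _ → c) ≡ fromℕ (length xs) * c
  Σ-const []       c = sym (QP.*-zeroˡ c)
  Σ-const (x ∷ xs) c = begin
      c + Σ[ xs ] (λ _ → c)              ≡⟨ cong (c +_) (Σ-const xs c) ⟩
      c + fromℕ (length xs) * c          ≡⟨ solve 2 (λ c l → c :+ l :* c := (con 1ℚ :+ l) :* c) refl c (fromℕ (length xs)) ⟩
      (1ℚ + fromℕ (length xs)) * c       ≡⟨ cong (_* c) (fromℕ-suc (length xs)) ⟨
      fromℕ (suc (length xs)) * c        ∎
    where open ≡-Reasoning

  Σ-filter : ∀ (xs : List A) {P : A → Set} (P? : ∀ x → Dec (P x)) f →
    Σ[ filter P? xs ] f ≡ Σ[ xs ] (λ x → if does (P? x) then f x else 0ℚ)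
  Σ-filter []       P? f = refl
  Σ-filter (x ∷ xs) P? f with does (P? x)
  ... | true  = cong (f x +_) (Σ-filter xs P? f)
  ... | false = trans (Σ-filter xs P? f) (sym (QP.+-identityˡ _))

  length-filter-Σ : ∀ (xs : List A) {P : A → Set} (P? : ∀ x → Dec (P x)) →
    fromℕ (length (filter P? xs)) ≡ Σ[ xs ] (λ x → if does (P? x) then 1ℚ else 0ℚ)
  length-filter-Σ []       P? = refl
  length-filter-Σ (x ∷ xs) P? with does (P? x)
  ... | true  = trans (fromℕ-suc (length (filter P? xs))) (cong (1ℚ +_) (length-filter-Σ xs P?))
  ... | false = trans (length-filter-Σ xs P?) (sym (QP.+-identityˡ _))

module _ {A B : Set} where

  Σ-map : ∀ (g : A → B) (xs : List A) f → Σ[ map g xs ] f ≡ Σ[ xs ] (λ x → f (g x))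
  Σ-map g []       f = refl
  Σ-map g (x ∷ xs) f = cong (f (g x) +_) (Σ-map g xs f)

  Σ-swap : ∀ (xs : List A) (ys : List B) (F : A → B → ℚ) →
    Σ[ xs ] (λ x → Σ[ ys ] (F x)) ≡ Σ[ ys ] (λ y → Σ[ xs ] (λ x → F x y))
  Σ-swap []       ys F = sym (Σ-0 ys)
  Σ-swap (x ∷ xs) ys F = begin
      Σ[ ys ] (F x) + Σ[ xs ] (λ x' → Σ[ ys ] (F x'))               ≡⟨ cong (Σ[ ys ] (F x) +_) (Σ-swap xs ys F) ⟩
      Σ[ ys ] (F x) + Σ[ ys ] (λ y → Σ[ xs ] (λ x' → F x' y))        ≡⟨ Σ-+ ys (F x) (λ y → Σ[ xs ] (λ x' → F x' y)) ⟨
      Σ[ ys ] (λ y → F x y + Σ[ xs ] (λ x' → F x' y))                ∎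
    where open ≡-Reasoning

sumFin : ∀ {m} → (Fin m → ℚ) → ℚ
sumFin {zero}  f = 0ℚ
sumFin {suc m} f = f zero + sumFin (λ j → f (suc j))

sumFin-cong : ∀ {m} {f g : Fin m → ℚ} → (∀ j → f j ≡ g j) → sumFin f ≡ sumFin g
sumFin-cong {zero}  e = refl
sumFin-cong {suc m} e = cong₂ _+_ (e zero) (sumFin-cong (λ j → e (suc j)))

sumFin-*ˡ : ∀ {m} c (f : Fin m → ℚ) → sumFin (λ j → c * f j) ≡ c * sumFin f
sumFin-*ˡ {zero}  c f = sym (QP.*-zeroʳ c)
sumFin-*ˡ {suc m} c f = trans (cong (c * f zero +_) (sumFin-*ˡ c (λ j → f (suc j))))
  (sym (QP.*-distribˡ-+ c (f zero) _))

sumFin-+ : ∀ {m} (f g : Fin m → ℚ) → sumFin (λ j → f j + g j) ≡ sumFin f + sumFin g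
sumFin-+ {zero}  f g = refl
sumFin-+ {suc m} f g = trans (cong ((f zero + g zero) +_) (sumFin-+ (λ j → f (suc j)) (λ j → g (suc j))))
  (solve 4 (λ a b c d → (a :+ b) :+ (c :+ d) := (a :+ c) :+ (b :+ d)) refl (f zero) (g zero) _ _)

sumFin-neg : ∀ {m} (f : Fin m → ℚ) → sumFin (λ j → - f j) ≡ - sumFin f
sumFin-neg {zero}  f = refl
sumFin-neg {suc m} f = trans (cong (- f zero +_) (sumFin-neg (λ j → f (suc j))))
  (sym (QP.neg-distrib-+ (f zero) _))

sumFin-minus : ∀ {m} (f g : Fin m → ℚ) → sumFin (λ j → f j - g j) ≡ sumFin f - sumFin g
sumFin-minus f g = trans (sumFin-+ f (λ j → - g j)) (cong (sumFin f +_) (sumFin-neg g))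

sumFin-const : ∀ m c → sumFin {m} (λ _ → c) ≡ fromℕ m * c
sumFin-const zero    c = sym (QP.*-zeroˡ c)
sumFin-const (suc m) c = trans (cong (c +_) (sumFin-const m c))
  (trans (solve 2 (λ c l → c :+ l :* c := (con 1ℚ :+ l) :* c) refl c (fromℕ m)) (cong (_* c) (sym (fromℕ-suc m))))

Σ-applyUpTo : ∀ (f : ℕ → ℕ) m (g : ℕ → ℚ) → Σ[ applyUpTo f m ] g ≡ sumFin {m} (λ j → g (f (toℕ j)))
Σ-applyUpTo f zero    g = refl
Σ-applyUpTo f (suc m) g = cong (g (f 0) +_) (Σ-applyUpTo (λ k → f (suc k)) m g)

Σ-sumFin : ∀ {A : Set} {m} (xs : List A) (F : A → Fin m → ℚ) →
  Σ[ xs ] (λ x → sumFin (F x)) ≡ sumFin (λ j → Σ[ xs ] (λ x → F x j))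
Σ-sumFin {m = zero}  xs F = Σ-0 xs
Σ-sumFin {m = suc m} xs F = trans (Σ-+ xs (λ x → F x zero) (λ x → sumFin (λ j → F x (suc j))))
  (cong (Σ[ xs ] (λ x → F x zero) +_) (Σ-sumFin xs (λ x j → F x (suc j))))

Σ-upTo-suc : ∀ k (g : ℕ → ℚ) → Σ[ upTo (suc k) ] g ≡ Σ[ upTo k ] g + g k
Σ-upTo-suc k g = trans (cong (λ L → Σ[ L ] g) (sym (LP.upTo-∷ʳ k)))
  (trans (Σ-++ (upTo k) (k ∷ []) g) (cong (Σ[ upTo k ] g +_) (QP.+-identityʳ (g k))))

-- Matrices indexed by sign vectors

Σ-states-suc : ∀ {m} (f : Sign (suc m) → ℚ) →
  Σ[ states (suc m) ] f ≡ Σ[ states m ] (λ x → f (true ∷ x)) + Σ[ states m ] (λ x → f (false ∷ x))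
Σ-states-suc {m} f = trans (Σ-++ (map (true ∷_) (states m)) (map (false ∷_) (states m)) f)
  (cong₂ _+_ (Σ-map (true ∷_) (states m) f) (Σ-map (false ∷_) (states m) f))

does-⇔ : ∀ {X Y : Set} (x? : Dec X) (y? : Dec Y) → (X → Y) → (Y → X) → does x? ≡ does y?
does-⇔ (yes x) (yes y) f g = refl
does-⇔ (no ¬x) (no ¬y) f g = refl
does-⇔ (yes x) (no ¬y) f g = ⊥-elim (¬y (f x))
does-⇔ (no ¬x) (yes y) f g = ⊥-elim (¬x (g y))

Id-sym : ∀ {m} (x y : Sign m) → Id x y ≡ Id y x
Id-sym x y = cong (if_then 1ℚ else 0ℚ) (does-⇔ (x ≟v y) (y ≟v x) sym sym)

Id-refl : ∀ {m} (x : Sign m) → Id x x ≡ 1ℚ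
Id-refl []          = refl
Id-refl (true ∷ x)  = Id-refl x
Id-refl (false ∷ x) = Id-refl x

Id-≢ : ∀ {m} {x y : Sign m} → x ≢ y → Id x y ≡ 0ℚ
Id-≢ {x = x} {y} x≢y with x ≟v y
... | yes x≡y = ⊥-elim (x≢y x≡y)
... | no _    = refl

Σ-select : ∀ {m} (s : Sign m) (φ : Sign m → ℚ) →
  Σ[ states m ] (λ z → if does (z ≟v s) then φ z else 0ℚ) ≡ φ s
Σ-select []          φ = QP.+-identityʳ (φ [])
Σ-select {suc m} (true ∷ s) φ =
  trans (Σ-states-suc (λ z → if does (z ≟v (true ∷ s)) then φ z else 0ℚ))
    (trans (cong₂ _+_ (Σ-select s (λ z → φ (true ∷ z))) (Σ-0 (states m))) (QP.+-identityʳ _))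
Σ-select {suc m} (false ∷ s) φ =
  trans (Σ-states-suc (λ z → if does (z ≟v (false ∷ s)) then φ z else 0ℚ))
    (trans (cong₂ _+_ (Σ-0 (states m)) (Σ-select s (λ z → φ (false ∷ z)))) (QP.+-identityˡ _))

*-if : ∀ b u v → v * (if b then u else 0ℚ) ≡ (if b then v * u else 0ℚ)
*-if true  u v = refl
*-if false u v = QP.*-zeroʳ v

Σ-*Id : ∀ {m} (s : Sign m) (f : Sign m → ℚ) → Σ[ states m ] (λ z → f z * Id z s) ≡ f s
Σ-*Id s f = trans (Σ-cong (states _) (λ z → *-if (does (z ≟v s)) 1ℚ (f z)))
  (trans (Σ-select s (λ z → f z * 1ℚ)) (QP.*-identityʳ (f s)))

Σ-Id* : ∀ {m} (s : Sign m) (f : Sign m → ℚ) → Σ[ states m ] (λ z → Id s z * f z) ≡ f s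
Σ-Id* s f = trans (Σ-cong (states _) (λ z → trans (QP.*-comm (Id s z) (f z)) (cong (f z *_) (Id-sym s z))))
  (Σ-*Id s f)

Σ-*diag : ∀ {m} (A : Mat m) d (x y : Sign m) → Σ[ states m ] (λ z → A x z * diag d z y) ≡ A x y * d y
Σ-*diag A d x y = trans (Σ-cong (states _) (λ z → *-if (does (z ≟v y)) (d z) (A x z)))
  (Σ-select y (λ z → A x z * d z))

infix 4 _≈M_
_≈M_ : ∀ {m} → Mat m → Mat m → Set
A ≈M B = ∀ x y → A x y ≡ B x y

≈M-refl : ∀ {m} {A : Mat m} → A ≈M A
≈M-refl x y = refl

≈M-sym : ∀ {m} {A B : Mat m} → A ≈M B → B ≈M A
≈M-sym e x y = sym (e x y)

≈M-trans : ∀ {m} {A B C : Mat m} → A ≈M B → B ≈M C → A ≈M C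
≈M-trans e f x y = trans (e x y) (f x y)

⊗-cong : ∀ {m} {A A' B B' : Mat m} → A ≈M A' → B ≈M B' → (A ⊗ B) ≈M (A' ⊗ B')
⊗-cong eA eB x y = Σ-cong (states _) (λ z → cong₂ _*_ (eA x z) (eB z y))

Id-⊗ : ∀ {m} (A : Mat m) → (Id ⊗ A) ≈M A
Id-⊗ A x y = Σ-Id* x (λ z → A z y)

Σ-*⊗ : ∀ {m} (μ : Sign m → ℚ) (A B : Mat m) y →
  Σ[ states m ] (λ x → μ x * (A ⊗ B) x y) ≡ Σ[ states m ] (λ z → Σ[ states m ] (λ x → μ x * A x z) * B z y)
Σ-*⊗ {m} μ A B y = begin
    Σ[ states m ] (λ x → μ x * Σ[ states m ] (λ z → A x z * B z y))
      ≡⟨ Σ-cong (states m) (λ x → trans (sym (Σ-*ˡ (states m) (μ x) (λ z → A x z * B z y)))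
           (Σ-cong (states m) (λ z → sym (QP.*-assoc (μ x) (A x z) (B z y))))) ⟩
    Σ[ states m ] (λ x → Σ[ states m ] (λ z → μ x * A x z * B z y))
      ≡⟨ Σ-swap (states m) (states m) (λ x z → μ x * A x z * B z y) ⟩
    Σ[ states m ] (λ z → Σ[ states m ] (λ x → μ x * A x z * B z y))
      ≡⟨ Σ-cong (states m) (λ z → Σ-*ʳ (states m) (B z y) (λ x → μ x * A x z)) ⟩
    Σ[ states m ] (λ z → Σ[ states m ] (λ x → μ x * A x z) * B z y) ∎
  where open ≡-Reasoning

⊗-assoc : ∀ {m} (A B D : Mat m) → ((A ⊗ B) ⊗ D) ≈M (A ⊗ (B ⊗ D))
⊗-assoc A B D x y = sym (Σ-*⊗ (A x) B D y)

Mat₂ : Set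
Mat₂ = Bool → Bool → ℚ

_⊗₂_ : Mat₂ → Mat₂ → Mat₂
(a ⊗₂ b) x y = a x true * b true y + a x false * b false y

Id₂ : Mat₂
Id₂ x y = if does (x BP.≟ y) then 1ℚ else 0ℚ

tensorPower : Mat₂ → ∀ {m} → Mat m
tensorPower a []       []       = 1ℚ
tensorPower a (x ∷ xs) (y ∷ ys) = a x y * tensorPower a xs ys

tensorPower-cong : ∀ {a b} → (∀ x y → a x y ≡ b x y) → ∀ {m} → tensorPower a {m} ≈M tensorPower b
tensorPower-cong e []       []       = refl
tensorPower-cong e (x ∷ xs) (y ∷ ys) = cong₂ _*_ (e x y) (tensorPower-cong e xs ys)

tensorPower-⊗ : ∀ a b {m} → (tensorPower a {m} ⊗ tensorPower b) ≈M tensorPower (a ⊗₂ b)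
tensorPower-⊗ a b []       []       = solve 0 (con 1ℚ :* con 1ℚ :+ con 0ℚ := con 1ℚ) refl
tensorPower-⊗ a b {suc m} (x ∷ xs) (y ∷ ys) = begin
    Σ[ states (suc m) ] (λ z → A (x ∷ xs) z * B z (y ∷ ys))
      ≡⟨ Σ-states-suc (λ z → A (x ∷ xs) z * B z (y ∷ ys)) ⟩
    Σ[ states m ] (λ z → a x true * A xs z * (b true y * B z ys))
      + Σ[ states m ] (λ z → a x false * A xs z * (b false y * B z ys))
      ≡⟨ cong₂ _+_ (factor true) (factor false) ⟩
    a x true * b true y * (A ⊗ B) xs ys + a x false * b false y * (A ⊗ B) xs ys
      ≡⟨ cong (λ t → a x true * b true y * t + a x false * b false y * t) (tensorPower-⊗ a b xs ys) ⟩
    a x true * b true y * AB xs ys + a x false * b false y * AB xs ys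
      ≡⟨ QP.*-distribʳ-+ (AB xs ys) (a x true * b true y) (a x false * b false y) ⟨
    AB (x ∷ xs) (y ∷ ys) ∎
  where
  open ≡-Reasoning
  A B AB : ∀ {k} → Mat k
  A = tensorPower a
  B = tensorPower b
  AB = tensorPower (a ⊗₂ b)
  factor : ∀ t → Σ[ states m ] (λ z → a x t * A xs z * (b t y * B z ys)) ≡ a x t * b t y * (A ⊗ B) xs ys
  factor t = trans (Σ-cong (states m) (λ z → solve 4 (λ p q r s → p :* q :* (r :* s) := p :* r :* (q :* s)) refl
                                                  (a x t) (A xs z) (b t y) (B z ys)))
    (Σ-*ˡ (states m) (a x t * b t y) (λ z → A xs z * B z ys))

Id≈tensorPower : ∀ {m} → Id {m} ≈M tensorPower Id₂
Id≈tensorPower []           []           = refl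
Id≈tensorPower (true ∷ xs)  (true ∷ ys)  = trans (Id≈tensorPower xs ys) (sym (QP.*-identityˡ _))
Id≈tensorPower (true ∷ xs)  (false ∷ ys) = sym (QP.*-zeroˡ (tensorPower Id₂ xs ys))
Id≈tensorPower (false ∷ xs) (true ∷ ys)  = sym (QP.*-zeroˡ (tensorPower Id₂ xs ys))
Id≈tensorPower (false ∷ xs) (false ∷ ys) = trans (Id≈tensorPower xs ys) (sym (QP.*-identityˡ _))

tensorPower-inverse : ∀ {a b} → (∀ x y → (a ⊗₂ b) x y ≡ Id₂ x y) → ∀ {m} → (tensorPower a {m} ⊗ tensorPower b) ≈M Id
tensorPower-inverse {a} {b} ab≡I =
  ≈M-trans (tensorPower-⊗ a b) (≈M-trans (tensorPower-cong ab≡I) (≈M-sym Id≈tensorPower))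

-- The eigenbasis

allMinus : ∀ {m} → Sign m
allMinus {m} = replicate m false

numPlus-allMinus : ∀ m → numPlus (allMinus {m}) ≡ 0
numPlus-allMinus zero    = refl
numPlus-allMinus (suc m) = numPlus-allMinus m

numPlus≡0⇒allMinus : ∀ {m} (S : Sign m) → numPlus S ≡ 0 → S ≡ allMinus
numPlus≡0⇒allMinus []          e  = refl
numPlus≡0⇒allMinus (true ∷ S)  ()
numPlus≡0⇒allMinus (false ∷ S) e  = cong (false ∷_) (numPlus≡0⇒allMinus S e)

g g⁻¹ : Mat₂
g t s = if t ∧ s then 0ℚ else 1ℚ
g⁻¹ true  true  = - 1ℚ
g⁻¹ true  false = 1ℚ
g⁻¹ false true  = 1ℚ
g⁻¹ false false = 0ℚ

G G⁻¹ : ∀ {m} → Mat m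
G   = tensorPower g
G⁻¹ = tensorPower g⁻¹

G⁻¹-G : ∀ {m} → (G⁻¹ {m} ⊗ G) ≈M Id
G⁻¹-G = tensorPower-inverse λ { true true → refl ; true false → refl ; false true → refl ; false false → refl }

G-G⁻¹ : ∀ {m} → (G {m} ⊗ G⁻¹) ≈M Id
G-G⁻¹ = tensorPower-inverse λ { true true → refl ; true false → refl ; false true → refl ; false false → refl }

G-allMinusʳ : ∀ {m} (T : Sign m) → G T allMinus ≡ 1ℚ
G-allMinusʳ []          = refl
G-allMinusʳ (true ∷ T)  = trans (QP.*-identityˡ _) (G-allMinusʳ T)
G-allMinusʳ (false ∷ T) = trans (QP.*-identityˡ _) (G-allMinusʳ T)

G-allMinusˡ : ∀ {m} (S : Sign m) → G allMinus S ≡ 1ℚ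
G-allMinusˡ []          = refl
G-allMinusˡ (true ∷ S)  = trans (QP.*-identityˡ _) (G-allMinusˡ S)
G-allMinusˡ (false ∷ S) = trans (QP.*-identityˡ _) (G-allMinusˡ S)

-- Subtracting offset (numPlus S) turns column S of G into an eigenvector of K*.
offset : ℕ → ℚ
offset zero    = 0ℚ
offset (suc k) = frac 1 (suc (suc k))

offset-numPlus-allMinus : ∀ {m} → offset (numPlus (allMinus {m})) ≡ 0ℚ
offset-numPlus-allMinus {m} = cong offset (numPlus-allMinus m)

U U⁻¹ : ∀ {m} → Mat m
U   S' S = Id S' S - Id S' allMinus * offset (numPlus S)
U⁻¹ S' S = Id S' S + Id S' allMinus * offset (numPlus S)

⊗-rankOne : ∀ {m} (a b c e : Sign m → ℚ) S' S →
  Σ[ states m ] (λ R → (Id S' R + a S' * b R) * (Id R S + c R * e S))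
    ≡ Id S' S + a S' * b S + c S' * e S + a S' * Σ[ states m ] (λ R → b R * c R) * e S
⊗-rankOne {m} a b c e S' S = begin
    Σ[ st ] (λ R → (Id S' R + a S' * b R) * (Id R S + c R * e S))
      ≡⟨ Σ-cong st (λ R → solve 6 (λ i j A B C E → (i :+ A :* B) :* (j :+ C :* E) :=
             ((i :* j :+ i :* (C :* E)) :+ (A :* B) :* j) :+ A :* (B :* C) :* E) refl
             (Id S' R) (Id R S) (a S') (b R) (c R) (e S)) ⟩
    Σ[ st ] (λ R → ((Id S' R * Id R S + Id S' R * (c R * e S)) + a S' * b R * Id R S) + a S' * (b R * c R) * e S)
      ≡⟨ Σ-+ st (λ R → (Id S' R * Id R S + Id S' R * (c R * e S)) + a S' * b R * Id R S) (λ R → a S' * (b R * c R) * e S) ⟩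
    Σ[ st ] (λ R → (Id S' R * Id R S + Id S' R * (c R * e S)) + a S' * b R * Id R S)
      + Σ[ st ] (λ R → a S' * (b R * c R) * e S)
      ≡⟨ cong₂ _+_ (trans (Σ-+ st (λ R → Id S' R * Id R S + Id S' R * (c R * e S)) (λ R → a S' * b R * Id R S))
                     (cong₂ _+_ (trans (Σ-+ st (λ R → Id S' R * Id R S) (λ R → Id S' R * (c R * e S)))
                                  (cong₂ _+_ (Σ-Id* S' (λ R → Id R S)) (Σ-Id* S' (λ R → c R * e S))))
                                (Σ-*Id S (λ R → a S' * b R))))
                   (trans (Σ-*ʳ st (e S) (λ R → a S' * (b R * c R))) (cong (_* e S) (Σ-*ˡ st (a S') (λ R → b R * c R)))) ⟩
    ((Id S' S + c S' * e S) + a S' * b S) + a S' * Σ[ st ] (λ R → b R * c R) * e S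
      ≡⟨ solve 4 (λ i x y z → ((i :+ x) :+ y) :+ z := ((i :+ y) :+ x) :+ z) refl
           (Id S' S) (c S' * e S) (a S' * b S) (a S' * Σ[ st ] (λ R → b R * c R) * e S) ⟩
    Id S' S + a S' * b S + c S' * e S + a S' * Σ[ st ] (λ R → b R * c R) * e S ∎
  where
  open ≡-Reasoning
  st : List (Sign m)
  st = states m

module _ {m : ℕ} where
  private
    e₀ : Sign m → ℚ
    e₀ R = Id R allMinus
    c : Sign m → ℚ
    c R = offset (numPlus R)

    -- the offset vanishes at the only point where e₀ does not
    c·e₀ : Σ[ states m ] (λ R → c R * e₀ R) ≡ 0ℚ
    c·e₀ = trans (Σ-*Id allMinus c) (offset-numPlus-allMinus {m})

    U-rankOne : ∀ S' S → U S' S ≡ Id S' S + (- e₀ S') * c S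
    U-rankOne S' S = cong (Id S' S +_) (QP.neg-distribˡ-* (e₀ S') (c S))

  U⁻¹-U : (U⁻¹ ⊗ U) ≈M Id
  U⁻¹-U S' S = begin
      (U⁻¹ ⊗ U) S' S
        ≡⟨ Σ-cong (states m) (λ R → cong (U⁻¹ S' R *_) (U-rankOne R S)) ⟩
      Σ[ states m ] (λ R → U⁻¹ S' R * (Id R S + (- e₀ R) * c S))
        ≡⟨ ⊗-rankOne e₀ c (λ R → - e₀ R) c S' S ⟩
      Id S' S + e₀ S' * c S + (- e₀ S') * c S + e₀ S' * Σ[ states m ] (λ R → c R * (- e₀ R)) * c S
        ≡⟨ cong (λ t → Id S' S + e₀ S' * c S + (- e₀ S') * c S + e₀ S' * t * c S)
             (trans (Σ-cong (states m) (λ R → sym (QP.neg-distribʳ-* (c R) (e₀ R))))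
               (trans (Σ-neg (states m) (λ R → c R * e₀ R)) (cong -_ c·e₀))) ⟩
      Id S' S + e₀ S' * c S + (- e₀ S') * c S + e₀ S' * (- 0ℚ) * c S
        ≡⟨ solve 3 (λ i z w → i :+ z :* w :+ (:- z) :* w :+ z :* (:- con 0ℚ) :* w := i) refl (Id S' S) (e₀ S') (c S) ⟩
      Id S' S ∎
    where open ≡-Reasoning

  U-U⁻¹ : (U ⊗ U⁻¹) ≈M Id
  U-U⁻¹ S' S = begin
      (U ⊗ U⁻¹) S' S
        ≡⟨ Σ-cong (states m) (λ R → cong (_* U⁻¹ R S) (U-rankOne S' R)) ⟩
      Σ[ states m ] (λ R → (Id S' R + (- e₀ S') * c R) * U⁻¹ R S)
        ≡⟨ ⊗-rankOne (λ R → - e₀ R) c e₀ c S' S ⟩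
      Id S' S + (- e₀ S') * c S + e₀ S' * c S + (- e₀ S') * Σ[ states m ] (λ R → c R * e₀ R) * c S
        ≡⟨ cong (λ t → Id S' S + (- e₀ S') * c S + e₀ S' * c S + (- e₀ S') * t * c S) c·e₀ ⟩
      Id S' S + (- e₀ S') * c S + e₀ S' * c S + (- e₀ S') * 0ℚ * c S
        ≡⟨ solve 3 (λ i z w → i :+ (:- z) :* w :+ z :* w :+ (:- z) :* con 0ℚ :* w := i) refl (Id S' S) (e₀ S') (c S) ⟩
      Id S' S ∎
    where open ≡-Reasoning

P P⁻¹ : ∀ {m} → Mat m
P   = G ⊗ U
P⁻¹ = U⁻¹ ⊗ G⁻¹

⊗-inverse : ∀ {m} {A A⁻¹ B B⁻¹ : Mat m} → (A⁻¹ ⊗ A) ≈M Id → (B⁻¹ ⊗ B) ≈M Id → ((A⁻¹ ⊗ B⁻¹) ⊗ (B ⊗ A)) ≈M Id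
⊗-inverse {A = A} {A⁻¹} {B} {B⁻¹} A⁻¹A B⁻¹B =
  ≈M-trans (⊗-assoc A⁻¹ B⁻¹ (B ⊗ A))
  (≈M-trans (⊗-cong (≈M-refl {A = A⁻¹}) (≈M-sym (⊗-assoc B⁻¹ B A)))
  (≈M-trans (⊗-cong (≈M-refl {A = A⁻¹}) (⊗-cong B⁻¹B (≈M-refl {A = A})))
  (≈M-trans (⊗-cong (≈M-refl {A = A⁻¹}) (Id-⊗ A)) A⁻¹A)))

P⁻¹-P : ∀ {m} → (P⁻¹ {m} ⊗ P) ≈M Id
P⁻¹-P = ⊗-inverse {A = U} {U⁻¹} {G} {G⁻¹} U⁻¹-U G⁻¹-G

P-P⁻¹ : ∀ {m} → (P {m} ⊗ P⁻¹) ≈M Id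
P-P⁻¹ = ⊗-inverse {A = G⁻¹} {G} {U⁻¹} {U} G-G⁻¹ U-U⁻¹

P-entry : ∀ {m} (T S : Sign m) → P T S ≡ G T S - offset (numPlus S)
P-entry {m} T S = begin
    Σ[ states m ] (λ R → G T R * (Id R S - Id R allMinus * c))
      ≡⟨ Σ-cong (states m) (λ R → solve 4 (λ g i z w → g :* (i :- z :* w) := g :* i :- g :* z :* w) refl
                                     (G T R) (Id R S) (Id R allMinus) c) ⟩
    Σ[ states m ] (λ R → G T R * Id R S - G T R * Id R allMinus * c)
      ≡⟨ Σ-minus (states m) (λ R → G T R * Id R S) (λ R → G T R * Id R allMinus * c) ⟩
    Σ[ states m ] (λ R → G T R * Id R S) - Σ[ states m ] (λ R → G T R * Id R allMinus * c)
      ≡⟨ cong₂ _-_ (Σ-*Id S (G T)) (trans (Σ-*ʳ (states m) c (λ R → G T R * Id R allMinus))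
                                     (cong (_* c) (trans (Σ-*Id allMinus (G T)) (G-allMinusʳ T)))) ⟩
    G T S - 1ℚ * c
      ≡⟨ cong (λ t → G T S - t) (QP.*-identityˡ c) ⟩
    G T S - c ∎
  where
  open ≡-Reasoning
  c : ℚ
  c = offset (numPlus S)

-- The kernel as an average over the draws

module _ (n m : ℕ) where

  step-< : ∀ i (x : Sign m) (i<m : i ℕ.< m) → step n m i x ≡ updateAt x (fromℕ< i<m) (λ _ → true)
  step-< i x i<m with i <? m
  ... | yes i<m' = cong (λ p → updateAt x (fromℕ< p) (λ _ → true)) (ℕP.<-irrelevant i<m' i<m)
  ... | no  i≮m  = ⊥-elim (i≮m i<m)

  step-idle : ∀ i (x : Sign m) → m ℕ.≤ i → i ≢ n ∸ 1 → step n m i x ≡ x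
  step-idle i x m≤i i≢ with i <? m
  ... | yes i<m = ⊥-elim (ℕP.<-irrefl refl (ℕP.<-≤-trans i<m m≤i))
  ... | no _ with i ℕ.≟ (n ∸ 1)
  ...   | yes i≡ = ⊥-elim (i≢ i≡)
  ...   | no _   = refl

  step-reset : ∀ (x : Sign m) → m ℕ.≤ n ∸ 1 → step n m (n ∸ 1) x ≡ allMinus
  step-reset x m≤ with (n ∸ 1) <? m
  ... | yes n-1<m = ⊥-elim (ℕP.<-irrefl refl (ℕP.<-≤-trans n-1<m m≤))
  ... | no _ with (n ∸ 1) ℕ.≟ (n ∸ 1)
  ...   | yes _ = refl
  ...   | no ≢  = ⊥-elim (≢ refl)

setPlus : ∀ {m} → Sign m → Fin m → Sign m
setPlus x j = updateAt x j (λ _ → true)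

Σ-draws : ∀ n' m → m ℕ.≤ n' → (F : Sign m → ℚ) (x : Sign m) →
  Σ[ upTo (suc n') ] (λ i → F (step (suc n') m i x))
    ≡ sumFin (λ j → F (setPlus x j)) + fromℕ (n' ∸ m) * F x + F allMinus
Σ-draws n' m m≤n' F x = begin
    Σ[ upTo (suc n') ] f                                    ≡⟨ Σ-upTo-suc n' f ⟩
    Σ[ upTo n' ] f + f n'                                   ≡⟨ cong₂ _+_ (trans (cong (λ k → Σ[ upTo k ] f) (sym (ℕP.m+[n∸m]≡n m≤n')))
                                                                                 (idle-draws (n' ∸ m) (ℕP.≤-reflexive (ℕP.m+[n∸m]≡n m≤n'))))
                                                                        (cong F (step-reset (suc n') m x m≤n')) ⟩
    Σ[ upTo m ] f + fromℕ (n' ∸ m) * F x + F allMinus       ≡⟨ cong (λ t → t + fromℕ (n' ∸ m) * F x + F allMinus) switching-draws ⟩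
    sumFin (λ j → F (setPlus x j)) + fromℕ (n' ∸ m) * F x + F allMinus ∎
  where
  open ≡-Reasoning
  f : ℕ → ℚ
  f i = F (step (suc n') m i x)

  switching-draws : Σ[ upTo m ] f ≡ sumFin (λ j → F (setPlus x j))
  switching-draws = trans (Σ-applyUpTo (λ k → k) m f) (sumFin-cong (λ j → cong F
    (trans (step-< (suc n') m (toℕ j) x (FP.toℕ<n j))
           (cong (λ w → updateAt x w (λ _ → true)) (FP.fromℕ<-toℕ j (FP.toℕ<n j))))))

  idle-draws : ∀ d → m ℕ.+ d ℕ.≤ n' → Σ[ upTo (m ℕ.+ d) ] f ≡ Σ[ upTo m ] f + fromℕ d * F x
  idle-draws zero _ = trans (cong (λ k → Σ[ upTo k ] f) (ℕP.+-identityʳ m))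
                  (sym (trans (cong (Σ[ upTo m ] f +_) (QP.*-zeroˡ (F x))) (QP.+-identityʳ _)))
  idle-draws (suc d) m+d<n' = begin
      Σ[ upTo (m ℕ.+ suc d) ] f                     ≡⟨ cong (λ k → Σ[ upTo k ] f) (ℕP.+-suc m d) ⟩
      Σ[ upTo (suc (m ℕ.+ d)) ] f                   ≡⟨ Σ-upTo-suc (m ℕ.+ d) f ⟩
      Σ[ upTo (m ℕ.+ d) ] f + f (m ℕ.+ d)           ≡⟨ cong₂ _+_ (idle-draws d (ℕP.≤-trans (ℕP.+-monoʳ-≤ m (ℕP.n≤1+n d)) m+d<n'))
                                                                 (cong F (step-idle (suc n') m (m ℕ.+ d) x (ℕP.m≤m+n m d) m+d≢n')) ⟩
      Σ[ upTo m ] f + fromℕ d * F x + F x           ≡⟨ solve 3 (λ a b c → a :+ b :* c :+ c := a :+ (con 1ℚ :+ b) :* c) refl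
                                                         (Σ[ upTo m ] f) (fromℕ d) (F x) ⟩
      Σ[ upTo m ] f + (1ℚ + fromℕ d) * F x          ≡⟨ cong (λ t → Σ[ upTo m ] f + t * F x) (fromℕ-suc d) ⟨
      Σ[ upTo m ] f + fromℕ (suc d) * F x ∎
    where
    m+d≢n' : m ℕ.+ d ≢ n'
    m+d≢n' e = ℕP.<-irrefl e (ℕP.<-≤-trans (ℕP.≤-reflexive (sym (ℕP.+-suc m d))) m+d<n')

module Kernel (n' m : ℕ) where
  n : ℕ
  n = suc n'

  r : ℚ
  r = frac 1 n

  K : Mat m
  K = Kstar n m

  r*n≡1 : r * fromℕ n ≡ 1ℚ
  r*n≡1 = frac*fromℕ 1 n'

  K-entry : ∀ x y → K x y ≡ r * Σ[ upTo n ] (λ i → Id (step n m i x) y)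
  K-entry x y = trans (frac≡fromℕ*frac1 (length (filter (λ i → step n m i x ≟v y) (upTo n))) n)
    (trans (cong (_* r) (length-filter-Σ (upTo n) (λ i → step n m i x ≟v y))) (QP.*-comm _ r))

  K-apply : ∀ x (f : Sign m → ℚ) → Σ[ states m ] (λ y → K x y * f y) ≡ r * Σ[ upTo n ] (λ i → f (step n m i x))
  K-apply x f = begin
      Σ[ states m ] (λ y → K x y * f y)
        ≡⟨ Σ-cong (states m) (λ y → trans (cong (_* f y) (K-entry x y))
             (trans (QP.*-assoc r _ (f y)) (cong (r *_) (sym (Σ-*ʳ (upTo n) (f y) (λ i → Id (step n m i x) y)))))) ⟩
      Σ[ states m ] (λ y → r * Σ[ upTo n ] (λ i → Id (step n m i x) y * f y))
        ≡⟨ Σ-*ˡ (states m) r _ ⟩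
      r * Σ[ states m ] (λ y → Σ[ upTo n ] (λ i → Id (step n m i x) y * f y))
        ≡⟨ cong (r *_) (Σ-swap (states m) (upTo n) (λ y i → Id (step n m i x) y * f y)) ⟩
      r * Σ[ upTo n ] (λ i → Σ[ states m ] (λ y → Id (step n m i x) y * f y))
        ≡⟨ cong (r *_) (Σ-cong (upTo n) (λ i → Σ-Id* (step n m i x) f)) ⟩
      r * Σ[ upTo n ] (λ i → f (step n m i x)) ∎
    where open ≡-Reasoning

  K-applyᵀ : ∀ (μ : Sign m → ℚ) y →
    Σ[ states m ] (λ x → μ x * K x y) ≡ r * Σ[ states m ] (λ x → μ x * Σ[ upTo n ] (λ i → Id (step n m i x) y))
  K-applyᵀ μ y = trans (Σ-cong (states m) (λ x → trans (cong (μ x *_) (K-entry x y))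
                   (solve 3 (λ a b c → a :* (b :* c) := b :* (a :* c)) refl (μ x) r _)))
    (Σ-*ˡ (states m) r _)

  Σ-K : ∀ x → Σ[ states m ] (K x) ≡ 1ℚ
  Σ-K x = begin
      Σ[ states m ] (K x)                  ≡⟨ Σ-cong (states m) (λ y → sym (QP.*-identityʳ (K x y))) ⟩
      Σ[ states m ] (λ y → K x y * 1ℚ)     ≡⟨ K-apply x (λ _ → 1ℚ) ⟩
      r * Σ[ upTo n ] (λ _ → 1ℚ)           ≡⟨ cong (r *_) (trans (Σ-const (upTo n) 1ℚ)
                                                (trans (QP.*-identityʳ _) (cong fromℕ (LP.length-upTo n)))) ⟩
      r * fromℕ n                          ≡⟨ r*n≡1 ⟩
      1ℚ                                   ∎
    where open ≡-Reasoning

-- The eigenvalue equation K* P = P D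

numMinus : ∀ {m} → Sign m → ℕ
numMinus []          = 0
numMinus (true ∷ x)  = numMinus x
numMinus (false ∷ x) = suc (numMinus x)

numPlus+numMinus : ∀ {m} (S : Sign m) → numPlus S ℕ.+ numMinus S ≡ m
numPlus+numMinus []          = refl
numPlus+numMinus (true ∷ S)  = cong suc (numPlus+numMinus S)
numPlus+numMinus (false ∷ S) = trans (ℕP.+-suc (numPlus S) (numMinus S)) (cong suc (numPlus+numMinus S))

numPlus≤ : ∀ {m} (S : Sign m) → numPlus S ℕ.≤ m
numPlus≤ S = ℕP.≤-trans (ℕP.m≤m+n (numPlus S) (numMinus S)) (ℕP.≤-reflexive (numPlus+numMinus S))

Σ-setPlus-G : ∀ {m} (x S : Sign m) → sumFin (λ j → G (setPlus x j) S) ≡ fromℕ (numMinus S) * G x S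
Σ-setPlus-G []      []      = sym (QP.*-zeroˡ 1ℚ)
Σ-setPlus-G (a ∷ x) (s ∷ S) = begin
    G (true ∷ x) (s ∷ S) + sumFin (λ j → g a s * G (setPlus x j) S)
      ≡⟨ cong (G (true ∷ x) (s ∷ S) +_) (trans (sumFin-*ˡ (g a s) (λ j → G (setPlus x j) S))
                                              (cong (g a s *_) (Σ-setPlus-G x S))) ⟩
    g true s * G x S + g a s * (fromℕ (numMinus S) * G x S)
      ≡⟨ first-coordinate a s ⟩
    fromℕ (numMinus (s ∷ S)) * (g a s * G x S) ∎
  where
  open ≡-Reasoning
  plus-absent : 1ℚ * G x S + 1ℚ * (fromℕ (numMinus S) * G x S) ≡ fromℕ (suc (numMinus S)) * (1ℚ * G x S)
  plus-absent = trans (solve 2 (λ M γ → con 1ℚ :* γ :+ con 1ℚ :* (M :* γ) := (con 1ℚ :+ M) :* (con 1ℚ :* γ)) refl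
                                (fromℕ (numMinus S)) (G x S))
                  (cong (_* (1ℚ * G x S)) (sym (fromℕ-suc (numMinus S))))
  first-coordinate : ∀ a s → g true s * G x S + g a s * (fromℕ (numMinus S) * G x S) ≡ fromℕ (numMinus (s ∷ S)) * (g a s * G x S)
  first-coordinate true  true  = solve 2 (λ M γ → con 0ℚ :* γ :+ con 0ℚ :* (M :* γ) := M :* (con 0ℚ :* γ)) refl (fromℕ (numMinus S)) (G x S)
  first-coordinate false true  = solve 2 (λ M γ → con 0ℚ :* γ :+ con 1ℚ :* (M :* γ) := M :* (con 1ℚ :* γ)) refl (fromℕ (numMinus S)) (G x S)
  first-coordinate true  false = plus-absent
  first-coordinate false false = plus-absent

P-allMinus : ∀ {m} (y : Sign m) → P y allMinus ≡ 1ℚ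
P-allMinus {m} y = trans (P-entry y allMinus)
  (cong₂ _-_ (G-allMinusʳ y) (offset-numPlus-allMinus {m}))

eigenvalue : ℕ → ℕ → ℚ
eigenvalue n zero    = 1ℚ
eigenvalue n (suc k) = frac (n ∸ suc k ∸ 1) n

offset-inverse : ∀ k → offset (suc k) * fromℕ (suc (suc k)) ≡ 1ℚ
offset-inverse k = frac*fromℕ 1 (suc k)

numMinus-+-idle : ∀ {m} n' (S : Sign m) a → numPlus S ≡ suc a → m ℕ.≤ n' →
  numMinus S ℕ.+ (n' ∸ m) ≡ suc n' ∸ suc a ∸ 1
numMinus-+-idle {m} n' S a eq m≤n' = begin
    numMinus S ℕ.+ (n' ∸ m)                          ≡⟨ ℕP.m+n∸m≡n (suc a) _ ⟨
    suc a ℕ.+ (numMinus S ℕ.+ (n' ∸ m)) ∸ suc a      ≡⟨ cong (_∸ suc a) (ℕP.+-assoc (suc a) (numMinus S) _) ⟨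
    suc a ℕ.+ numMinus S ℕ.+ (n' ∸ m) ∸ suc a        ≡⟨ cong (λ k → k ℕ.+ (n' ∸ m) ∸ suc a)
                                                          (trans (cong (ℕ._+ numMinus S) (sym eq)) (numPlus+numMinus S)) ⟩
    m ℕ.+ (n' ∸ m) ∸ suc a                           ≡⟨ cong (_∸ suc a) (ℕP.m+[n∸m]≡n m≤n') ⟩
    n' ∸ suc a                                       ≡⟨ trans (ℕP.∸-+-assoc n' a 1) (cong (n' ∸_) (ℕP.+-comm a 1)) ⟨
    n' ∸ a ∸ 1                                       ∎
  where open ≡-Reasoning

Σ-draws-P : ∀ n' m → m ℕ.≤ n' → ∀ x S k → numPlus S ≡ k →
  Σ[ upTo (suc n') ] (λ i → P (step (suc n') m i x) S) ≡ fromℕ (suc n') * (P x S * eigenvalue (suc n') k)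
Σ-draws-P n' m m≤n' x S zero eq = begin
    Σ[ upTo n ] (λ i → P (step n m i x) S)   ≡⟨ Σ-cong (upTo n) (λ i → P-column (step n m i x)) ⟩
    Σ[ upTo n ] (λ _ → 1ℚ)                   ≡⟨ trans (Σ-const (upTo n) 1ℚ) (cong (λ k → fromℕ k * 1ℚ) (LP.length-upTo n)) ⟩
    fromℕ n * 1ℚ                             ≡⟨ cong (λ t → fromℕ n * (t * 1ℚ)) (P-column x) ⟨
    fromℕ n * (P x S * 1ℚ)                   ∎
  where
  open ≡-Reasoning
  n : ℕ
  n = suc n'
  P-column : ∀ y → P y S ≡ 1ℚ
  P-column y = trans (cong (P y) (numPlus≡0⇒allMinus S eq)) (P-allMinus y)
Σ-draws-P n' m m≤n' x S (suc a) eq = begin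
    Σ[ upTo n ] (λ i → P (step n m i x) S)
      ≡⟨ Σ-draws n' m m≤n' (λ y → P y S) x ⟩
    sumFin (λ j → P (setPlus x j) S) + Y * P x S + P allMinus S
      ≡⟨ cong₂ (λ u v → u + Y * P x S + v)
           (trans (sumFin-cong (λ j → P-entryₛ (setPlus x j)))
             (trans (sumFin-minus (λ j → G (setPlus x j) S) (λ _ → c)) (cong₂ _-_ (Σ-setPlus-G x S) (sumFin-const m c))))
           (trans (P-entryₛ allMinus) (cong (_- c) (G-allMinusˡ S))) ⟩
    M * γ - fromℕ m * c + Y * P x S + (1ℚ - c)
      ≡⟨ cong₂ (λ u v → M * γ - u * c + Y * v + (1ℚ - c))
           (trans (cong fromℕ (sym (numPlus+numMinus S))) (trans (fromℕ-+ (numPlus S) (numMinus S)) (cong (λ k → fromℕ k + M) eq)))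
           (P-entryₛ x) ⟩
    M * γ - (fromℕ (suc a) + M) * c + Y * (γ - c) + (1ℚ - c)
      ≡⟨ solve 5 (λ M γ k c Y → M :* γ :- (k :+ M) :* c :+ Y :* (γ :- c) :+ (con 1ℚ :- c)
                     := (M :+ Y) :* (γ :- c) :+ (con 1ℚ :- c :* (k :+ con 1ℚ))) refl M γ (fromℕ (suc a)) c Y ⟩
    (M + Y) * (γ - c) + (1ℚ - c * (fromℕ (suc a) + 1ℚ))
      ≡⟨ cong (λ t → (M + Y) * (γ - c) + (1ℚ - t))
           (trans (cong (c *_) (trans (QP.+-comm (fromℕ (suc a)) 1ℚ) (sym (fromℕ-suc (suc a))))) (offset-inverse a)) ⟩
    (M + Y) * (γ - c) + (1ℚ - 1ℚ)
      ≡⟨ trans (cong ((M + Y) * (γ - c) +_) (QP.+-inverseʳ 1ℚ)) (QP.+-identityʳ _) ⟩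
    (M + Y) * (γ - c)
      ≡⟨ cong (_* (γ - c)) (trans (sym (fromℕ-+ (numMinus S) (n' ∸ m))) (cong fromℕ (numMinus-+-idle n' S a eq m≤n'))) ⟩
    fromℕ D * (γ - c)
      ≡⟨ cong (_* (γ - c)) (trans (sym (QP.*-identityˡ (fromℕ D))) (cong (_* fromℕ D) (sym r*n≡1))) ⟩
    r * fromℕ n * fromℕ D * (γ - c)
      ≡⟨ solve 4 (λ r N D p → r :* N :* D :* p := N :* (p :* (D :* r))) refl r (fromℕ n) (fromℕ D) (γ - c) ⟩
    fromℕ n * ((γ - c) * (fromℕ D * r))
      ≡⟨ cong₂ (λ u v → fromℕ n * (u * v)) (sym (P-entryₛ x)) (sym (frac≡fromℕ*frac1 D n)) ⟩
    fromℕ n * (P x S * frac D n) ∎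
  where
  open ≡-Reasoning
  open Kernel n' m using (n; r; r*n≡1)
  M : ℚ
  M = fromℕ (numMinus S)
  Y : ℚ
  Y = fromℕ (n' ∸ m)
  γ : ℚ
  γ = G x S
  c : ℚ
  c = offset (suc a)
  D : ℕ
  D = n ∸ suc a ∸ 1
  P-entryₛ : ∀ T → P T S ≡ G T S - c
  P-entryₛ T = trans (P-entry T S) (cong (λ k → G T S - offset k) eq)

K⊗P : ∀ n' m → m ℕ.≤ n' → ∀ x S → (Kstar (suc n') m ⊗ P) x S ≡ P x S * eigenvalue (suc n') (numPlus S)
K⊗P n' m m≤n' x S = begin
    Σ[ states m ] (λ y → K x y * P y S)                          ≡⟨ K-apply x (λ y → P y S) ⟩
    r * Σ[ upTo n ] (λ i → P (step n m i x) S)                   ≡⟨ cong (r *_) (Σ-draws-P n' m m≤n' x S (numPlus S) refl) ⟩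
    r * (fromℕ n * (P x S * eigenvalue n (numPlus S)))           ≡⟨ QP.*-assoc r (fromℕ n) _ ⟨
    r * fromℕ n * (P x S * eigenvalue n (numPlus S))             ≡⟨ trans (cong (_* (P x S * eigenvalue n (numPlus S))) r*n≡1) (QP.*-identityˡ _) ⟩
    P x S * eigenvalue n (numPlus S)                             ∎
  where
  open ≡-Reasoning
  open Kernel n' m

-- Multiplicities

count-numPlus : ∀ m j → Σ[ states m ] (λ s → if does (numPlus s ℕ.≟ j) then 1ℚ else 0ℚ) ≡ fromℕ (m C j)
count-numPlus zero    zero    = refl
count-numPlus zero    (suc j) = refl
count-numPlus (suc m) j = trans (Σ-states-suc {m} (λ s → if does (numPlus s ℕ.≟ j) then 1ℚ else 0ℚ)) (pascal j)
  where
  pascal : ∀ j → Σ[ states m ] (λ s → if does (suc (numPlus s) ℕ.≟ j) then 1ℚ else 0ℚ)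
                   + Σ[ states m ] (λ s → if does (numPlus s ℕ.≟ j) then 1ℚ else 0ℚ)
                 ≡ fromℕ (suc m C j)
  pascal zero    = trans (cong₂ _+_ (Σ-0 (states m)) (count-numPlus m 0)) (QP.+-identityˡ _)
  pascal (suc j) = trans (cong₂ _+_ (count-numPlus m j) (count-numPlus m (suc j)))
    (trans (sym (fromℕ-+ (m C j) (m C suc j))) (cong fromℕ (nCk+nC[k+1]≡[n+1]C[k+1] m j)))

length-filter-numPlus : ∀ m j → length (filter (λ s → numPlus s ℕ.≟ j) (states m)) ≡ m C j
length-filter-numPlus m j =
  fromℕ-injective (trans (length-filter-Σ (states m) (λ s → numPlus s ℕ.≟ j)) (count-numPlus m j))

module _ (n' : ℕ) where
  private
    n : ℕ
    n = suc n'

    numerator : ℕ → ℕ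
    numerator zero    = n
    numerator (suc k) = n ∸ suc k ∸ 1

    eigenvalue*n : ∀ k → eigenvalue n k * fromℕ n ≡ fromℕ (numerator k)
    eigenvalue*n zero    = QP.*-identityˡ (fromℕ n)
    eigenvalue*n (suc k) = frac*fromℕ (n ∸ suc k ∸ 1) n'

    numerator-suc< : ∀ b → numerator (suc b) ℕ.< n
    numerator-suc< b = s≤s (ℕP.≤-trans (ℕP.m∸n≤m (n' ∸ b) 1) (ℕP.m∸n≤m n' b))

    numerator-injective : ∀ k j → k ℕ.≤ n' → j ℕ.≤ n' → numerator k ≡ numerator j → k ≡ j
    numerator-injective zero    zero    _ _ _ = refl
    numerator-injective zero    (suc b) _ _ e = ⊥-elim (ℕP.<-irrefl (sym e) (numerator-suc< b))
    numerator-injective (suc a) zero    _ _ e = ⊥-elim (ℕP.<-irrefl e (numerator-suc< a))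
    numerator-injective (suc a) (suc b) a<n' b<n' e = ℕP.suc-injective
      (ℕP.∸-cancelˡ-≡ (s≤s a<n') (s≤s b<n') (trans (sym (numerator-suc a)) (trans e (numerator-suc b))))
      where
      numerator-suc : ∀ c → numerator (suc c) ≡ n ∸ suc (suc c)
      numerator-suc c = trans (ℕP.∸-+-assoc n (suc c) 1) (cong (n ∸_) (ℕP.+-comm (suc c) 1))

  eigenvalue-injective : ∀ k j → k ℕ.≤ n' → j ℕ.≤ n' → eigenvalue n k ≡ eigenvalue n j → k ≡ j
  eigenvalue-injective k j k≤ j≤ e = numerator-injective k j k≤ j≤
    (fromℕ-injective (trans (sym (eigenvalue*n k)) (trans (cong (_* fromℕ n) e) (eigenvalue*n j))))

mult-eigenvalue : ∀ n' m → m ℕ.≤ n' → ∀ j → j ℕ.≤ n' →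
  mult m (λ S → eigenvalue (suc n') (numPlus S)) (eigenvalue (suc n') j) ≡ m C j
mult-eigenvalue n' m m≤n' j j≤n' =
  trans (cong length (LP.filter-≐ (λ s → eigenvalue (suc n') (numPlus s) QP.≟ eigenvalue (suc n') j)
                                  (λ s → numPlus s ℕ.≟ j)
                                  ((λ {s} → eigenvalue-injective n' (numPlus s) j (ℕP.≤-trans (numPlus≤ s) m≤n') j≤n') ,
                                   (λ {s} → cong (eigenvalue (suc n')))) (states m)))
    (length-filter-numPlus m j)

-- The stationary distribution

nCk>0 : ∀ m k → k ℕ.≤ m → 0 ℕ.< m C k
nCk>0 m       zero    _         = s≤s z≤n
nCk>0 (suc m) (suc k) (s≤s k≤m) = ℕP.<-≤-trans (nCk>0 m k k≤m)
  (ℕP.≤-trans (ℕP.m≤m+n (m C k) (m C suc k)) (ℕP.≤-reflexive (nCk+nC[k+1]≡[n+1]C[k+1] m k)))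

[k+1]*nC[k+1]≡[n-k]*nCk : ∀ n k → suc k ℕ.* (n C suc k) ≡ (n ∸ k) ℕ.* (n C k)
[k+1]*nC[k+1]≡[n-k]*nCk zero    k    = trans (ℕP.*-zeroʳ (suc k)) (sym (cong (ℕ._* (0 C k)) (ℕP.0∸n≡0 k)))
[k+1]*nC[k+1]≡[n-k]*nCk (suc n) zero = trans (ℕP.+-identityʳ _) (trans (nC1≡n (suc n)) (sym (ℕP.*-identityʳ (suc n))))
[k+1]*nC[k+1]≡[n-k]*nCk (suc n) (suc k) = begin
    suc (suc k) ℕ.* (suc n C suc (suc k))
      ≡⟨ cong (suc (suc k) ℕ.*_) (nCk+nC[k+1]≡[n+1]C[k+1] n (suc k)) ⟨
    suc (suc k) ℕ.* (n C suc k ℕ.+ n C suc (suc k))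
      ≡⟨ ℕP.*-distribˡ-+ (suc (suc k)) (n C suc k) _ ⟩
    suc (suc k) ℕ.* (n C suc k) ℕ.+ suc (suc k) ℕ.* (n C suc (suc k))
      ≡⟨ cong (suc (suc k) ℕ.* (n C suc k) ℕ.+_) ([k+1]*nC[k+1]≡[n-k]*nCk n (suc k)) ⟩
    suc (suc k) ℕ.* (n C suc k) ℕ.+ (n ∸ suc k) ℕ.* (n C suc k)
      ≡⟨ ℕP.*-distribʳ-+ (n C suc k) (suc (suc k)) (n ∸ suc k) ⟨
    (suc (suc k) ℕ.+ (n ∸ suc k)) ℕ.* (n C suc k)
      ≡⟨ regroup ⟩
    (suc k ℕ.+ (n ∸ k)) ℕ.* (n C suc k)
      ≡⟨ ℕP.*-distribʳ-+ (n C suc k) (suc k) (n ∸ k) ⟩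
    suc k ℕ.* (n C suc k) ℕ.+ (n ∸ k) ℕ.* (n C suc k)
      ≡⟨ cong (ℕ._+ (n ∸ k) ℕ.* (n C suc k)) ([k+1]*nC[k+1]≡[n-k]*nCk n k) ⟩
    (n ∸ k) ℕ.* (n C k) ℕ.+ (n ∸ k) ℕ.* (n C suc k)
      ≡⟨ ℕP.*-distribˡ-+ (n ∸ k) (n C k) (n C suc k) ⟨
    (n ∸ k) ℕ.* (n C k ℕ.+ n C suc k)
      ≡⟨ cong ((n ∸ k) ℕ.*_) (nCk+nC[k+1]≡[n+1]C[k+1] n k) ⟩
    (suc n ∸ suc k) ℕ.* (suc n C suc k) ∎
  where
  open ≡-Reasoning
  regroup : (suc (suc k) ℕ.+ (n ∸ suc k)) ℕ.* (n C suc k) ≡ (suc k ℕ.+ (n ∸ k)) ℕ.* (n C suc k)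
  regroup with ℕP.≤-<-connex (suc k) n
  ... | inj₁ k<n = cong (ℕ._* (n C suc k)) (trans (sym (ℕP.+-suc (suc k) (n ∸ suc k)))
                                              (cong (suc k ℕ.+_) (sym (ℕP.+-∸-assoc 1 k<n))))
  ... | inj₂ n≤k = trans (vanish (suc (suc k) ℕ.+ (n ∸ suc k))) (sym (vanish (suc k ℕ.+ (n ∸ k))))
    where
    vanish : ∀ a → a ℕ.* (n C suc k) ≡ 0
    vanish a = trans (cong (a ℕ.*_) (k>n⇒nCk≡0 n≤k)) (ℕP.*-zeroʳ a)

frac1*fromℕ : ∀ c → c ≢ 0 → frac 1 c * fromℕ c ≡ 1ℚ
frac1*fromℕ zero    c≢0 = ⊥-elim (c≢0 refl)
frac1*fromℕ (suc c) _   = frac*fromℕ 1 c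

frac-cross : ∀ a b c d → c ≢ 0 → d ≢ 0 → a ℕ.* d ≡ b ℕ.* c → fromℕ a * frac 1 c ≡ fromℕ b * frac 1 d
frac-cross a b c d c≢0 d≢0 ad≡bc = begin
    fromℕ a * u                        ≡⟨ QP.*-identityʳ _ ⟨
    fromℕ a * u * 1ℚ                   ≡⟨ cong (fromℕ a * u *_) (frac1*fromℕ d d≢0) ⟨
    fromℕ a * u * (v * fromℕ d)        ≡⟨ solve 4 (λ A U V D → A :* U :* (V :* D) := (A :* D) :* (U :* V)) refl (fromℕ a) u v (fromℕ d) ⟩
    fromℕ a * fromℕ d * (u * v)        ≡⟨ cong (_* (u * v)) (trans (sym (fromℕ-* a d)) (trans (cong fromℕ ad≡bc) (fromℕ-* b c))) ⟩
    fromℕ b * fromℕ c * (u * v)        ≡⟨ solve 4 (λ B C U V → B :* C :* (U :* V) := B :* V :* (U :* C)) refl (fromℕ b) (fromℕ c) u v ⟩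
    fromℕ b * v * (u * fromℕ c)        ≡⟨ cong (fromℕ b * v *_) (frac1*fromℕ c c≢0) ⟩
    fromℕ b * v * 1ℚ                   ≡⟨ QP.*-identityʳ _ ⟩
    fromℕ b * v                        ∎
  where
  open ≡-Reasoning
  u : ℚ
  u = frac 1 c
  v : ℚ
  v = frac 1 d

πlevel : ℕ → ℕ → ℚ
πlevel m k = frac 1 (suc m ℕ.* (m C k))

[m+1]*mCk≢0 : ∀ m k → k ℕ.≤ m → suc m ℕ.* (m C k) ≢ 0
[m+1]*mCk≢0 m k k≤m e = ℕP.<-irrefl (sym (ℕP.m+n≡0⇒m≡0 (m C k) e)) (nCk>0 m k k≤m)

πlevel-cross : ∀ m k → suc k ℕ.≤ m → fromℕ (suc k) * πlevel m k ≡ fromℕ (m ∸ k) * πlevel m (suc k)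
πlevel-cross m k k<m = frac-cross (suc k) (m ∸ k) (suc m ℕ.* (m C k)) (suc m ℕ.* (m C suc k))
  ([m+1]*mCk≢0 m k (ℕP.≤-trans (ℕP.n≤1+n k) k<m)) ([m+1]*mCk≢0 m (suc k) k<m)
  (trans (swap (suc k) (suc m) (m C suc k))
    (trans (cong (suc m ℕ.*_) ([k+1]*nC[k+1]≡[n-k]*nCk m k)) (sym (swap (m ∸ k) (suc m) (m C k)))))
  where
  swap : ∀ a b c → a ℕ.* (b ℕ.* c) ≡ b ℕ.* (a ℕ.* c)
  swap a b c = trans (sym (ℕP.*-assoc a b c)) (trans (cong (ℕ._* c) (ℕP.*-comm a b)) (ℕP.*-assoc b a c))

sumBelow : ℕ → (ℕ → ℚ) → ℚ
sumBelow zero    f = 0ℚ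
sumBelow (suc k) f = f 0 + sumBelow k (λ j → f (suc j))

sumBelow-cong : ∀ k {f g : ℕ → ℚ} → (∀ j → j ℕ.< k → f j ≡ g j) → sumBelow k f ≡ sumBelow k g
sumBelow-cong zero    e = refl
sumBelow-cong (suc k) e = cong₂ _+_ (e 0 (s≤s z≤n)) (sumBelow-cong k (λ j j<k → e (suc j) (s≤s j<k)))

sumBelow-+ : ∀ k (f g : ℕ → ℚ) → sumBelow k (λ j → f j + g j) ≡ sumBelow k f + sumBelow k g
sumBelow-+ zero    f g = refl
sumBelow-+ (suc k) f g = trans (cong ((f 0 + g 0) +_) (sumBelow-+ k (λ j → f (suc j)) (λ j → g (suc j))))
  (solve 4 (λ a b c d → (a :+ b) :+ (c :+ d) := (a :+ c) :+ (b :+ d)) refl (f 0) (g 0) _ _)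

sumBelow-suc : ∀ k (f : ℕ → ℚ) → sumBelow (suc k) f ≡ sumBelow k f + f k
sumBelow-suc zero    f = trans (QP.+-identityʳ (f 0)) (sym (QP.+-identityˡ (f 0)))
sumBelow-suc (suc k) f = trans (cong (f 0 +_) (sumBelow-suc k (λ j → f (suc j)))) (sym (QP.+-assoc (f 0) _ _))

sumBelow-const : ∀ k c → sumBelow k (λ _ → c) ≡ fromℕ k * c
sumBelow-const zero    c = sym (QP.*-zeroˡ c)
sumBelow-const (suc k) c = trans (cong (c +_) (sumBelow-const k c))
  (trans (solve 2 (λ c l → c :+ l :* c := (con 1ℚ :+ l) :* c) refl c (fromℕ k)) (cong (_* c) (sym (fromℕ-suc k))))

Σ-numPlus : ∀ m (φ : ℕ → ℚ) → Σ[ states m ] (λ s → φ (numPlus s)) ≡ sumBelow (suc m) (λ j → fromℕ (m C j) * φ j)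
Σ-numPlus zero    φ = cong (_+ 0ℚ) (sym (QP.*-identityˡ (φ 0)))
Σ-numPlus (suc m) φ = begin
    Σ[ states (suc m) ] (λ s → φ (numPlus s))
      ≡⟨ Σ-states-suc {m} (λ s → φ (numPlus s)) ⟩
    Σ[ states m ] (λ s → φ (suc (numPlus s))) + Σ[ states m ] (λ s → φ (numPlus s))
      ≡⟨ cong₂ _+_ (Σ-numPlus m (λ j → φ (suc j))) (Σ-numPlus m φ) ⟩
    sumBelow (suc m) A + (φ₀ + sumBelow m B)
      ≡⟨ cong (λ t → sumBelow (suc m) A + (φ₀ + t)) (sym B-last) ⟩
    sumBelow (suc m) A + (φ₀ + sumBelow (suc m) B)
      ≡⟨ solve 3 (λ a b c → a :+ (b :+ c) := b :+ (a :+ c)) refl (sumBelow (suc m) A) φ₀ (sumBelow (suc m) B) ⟩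
    φ₀ + (sumBelow (suc m) A + sumBelow (suc m) B)
      ≡⟨ cong (φ₀ +_) (trans (sym (sumBelow-+ (suc m) A B)) (sumBelow-cong (suc m) (λ j _ → pascal j))) ⟩
    φ₀ + sumBelow (suc m) (λ j → fromℕ (suc m C suc j) * φ (suc j)) ∎
  where
  open ≡-Reasoning
  φ₀ : ℚ
  φ₀ = fromℕ 1 * φ 0
  A B : ℕ → ℚ
  A j = fromℕ (m C j) * φ (suc j)
  B j = fromℕ (m C suc j) * φ (suc j)
  B-last : sumBelow (suc m) B ≡ sumBelow m B
  B-last = trans (sumBelow-suc m B)
    (trans (cong (λ t → sumBelow m B + fromℕ t * φ (suc m)) (k>n⇒nCk≡0 (ℕP.n<1+n m)))
      (trans (cong (sumBelow m B +_) (QP.*-zeroˡ (φ (suc m)))) (QP.+-identityʳ _)))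
  pascal : ∀ j → A j + B j ≡ fromℕ (suc m C suc j) * φ (suc j)
  pascal j = trans (sym (QP.*-distribʳ-+ (φ (suc j)) (fromℕ (m C j)) (fromℕ (m C suc j))))
    (cong (_* φ (suc j)) (trans (sym (fromℕ-+ (m C j) (m C suc j))) (cong fromℕ (nCk+nC[k+1]≡[n+1]C[k+1] m j))))

Σ-πbar : ∀ m → Σ[ states m ] (πbar m) ≡ 1ℚ
Σ-πbar m = begin
    Σ[ states m ] (λ s → πlevel m (numPlus s))
      ≡⟨ Σ-numPlus m (πlevel m) ⟩
    sumBelow (suc m) (λ j → fromℕ (m C j) * πlevel m j)
      ≡⟨ sumBelow-cong (suc m) (λ j j<m+1 → trans
           (frac-cross (m C j) 1 (suc m ℕ.* (m C j)) (suc m) ([m+1]*mCk≢0 m j (ℕP.≤-pred j<m+1)) (λ ())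
             (trans (ℕP.*-comm (m C j) (suc m)) (sym (ℕP.*-identityˡ _))))
           (QP.*-identityˡ (frac 1 (suc m)))) ⟩
    sumBelow (suc m) (λ _ → frac 1 (suc m))
      ≡⟨ sumBelow-const (suc m) (frac 1 (suc m)) ⟩
    fromℕ (suc m) * frac 1 (suc m)
      ≡⟨ trans (QP.*-comm (fromℕ (suc m)) (frac 1 (suc m))) (frac*fromℕ 1 m) ⟩
    1ℚ ∎
  where open ≡-Reasoning

setMinus : ∀ {m} → Sign m → Fin m → Sign m
setMinus y j = updateAt y j (λ _ → false)

Σ-*Id-setPlus : ∀ {m} (μ : Sign m → ℚ) (j : Fin m) (y : Sign m) →
  Σ[ states m ] (λ x → μ x * Id (setPlus x j) y) ≡ (if lookup y j then μ (setPlus y j) + μ (setMinus y j) else 0ℚ)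
Σ-*Id-setPlus {suc m} μ zero (true ∷ y) = trans (Σ-states-suc (λ x → μ x * Id (setPlus x zero) (true ∷ y)))
  (cong₂ _+_ (Σ-*Id y (λ x → μ (true ∷ x))) (Σ-*Id y (λ x → μ (false ∷ x))))
Σ-*Id-setPlus {suc m} μ zero (false ∷ y) = trans (Σ-states-suc (λ x → μ x * Id (setPlus x zero) (false ∷ y)))
  (trans (cong₂ _+_ (Σ-*0 (states m) (λ x → μ (true ∷ x))) (Σ-*0 (states m) (λ x → μ (false ∷ x)))) (QP.+-identityʳ 0ℚ))
Σ-*Id-setPlus {suc m} μ (suc j) (true ∷ y) = trans (Σ-states-suc (λ x → μ x * Id (setPlus x (suc j)) (true ∷ y)))
  (trans (cong₂ _+_ (Σ-*Id-setPlus (λ x → μ (true ∷ x)) j y) (Σ-*0 (states m) (λ x → μ (false ∷ x)))) (QP.+-identityʳ _))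
Σ-*Id-setPlus {suc m} μ (suc j) (false ∷ y) = trans (Σ-states-suc (λ x → μ x * Id (setPlus x (suc j)) (false ∷ y)))
  (trans (cong₂ _+_ (Σ-*0 (states m) (λ x → μ (true ∷ x))) (Σ-*Id-setPlus (λ x → μ (false ∷ x)) j y)) (QP.+-identityˡ _))

setPlus-lookup : ∀ {m} (y : Sign m) j → lookup y j ≡ true → setPlus y j ≡ y
setPlus-lookup (true ∷ y) zero    _ = refl
setPlus-lookup (b ∷ y)    (suc j) e = cong (b ∷_) (setPlus-lookup y j e)

numPlus-setMinus : ∀ {m} (y : Sign m) j → lookup y j ≡ true → suc (numPlus (setMinus y j)) ≡ numPlus y
numPlus-setMinus (true ∷ y)  zero    _ = refl
numPlus-setMinus (true ∷ y)  (suc j) e = cong suc (numPlus-setMinus y j e)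
numPlus-setMinus (false ∷ y) (suc j) e = numPlus-setMinus y j e

numPlus≡0⇒lookup : ∀ {m} (y : Sign m) j → numPlus y ≡ 0 → lookup y j ≡ false
numPlus≡0⇒lookup (false ∷ y) zero    _ = refl
numPlus≡0⇒lookup (false ∷ y) (suc j) e = numPlus≡0⇒lookup y j e

sumFin-lookup : ∀ {m} (y : Sign m) c → sumFin (λ j → if lookup y j then c else 0ℚ) ≡ fromℕ (numPlus y) * c
sumFin-lookup []          c = sym (QP.*-zeroˡ c)
sumFin-lookup (true ∷ y)  c = trans (cong (c +_) (sumFin-lookup y c))
  (trans (solve 2 (λ c l → c :+ l :* c := (con 1ℚ :+ l) :* c) refl c (fromℕ (numPlus y)))
         (cong (_* c) (sym (fromℕ-suc (numPlus y)))))
sumFin-lookup (false ∷ y) c = trans (QP.+-identityˡ _) (sumFin-lookup y c)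

module Balance (n' m : ℕ) (m≤n' : m ℕ.≤ n') where
  open Kernel n' m

  -- n times the mass that μ K puts on y
  inflow : (Sign m → ℚ) → Sign m → ℚ
  inflow μ y = Σ[ states m ] (λ x → μ x * Σ[ upTo n ] (λ i → Id (step n m i x) y))

  inflow-≡ : ∀ μ y → inflow μ y ≡
    sumFin (λ j → if lookup y j then μ (setPlus y j) + μ (setMinus y j) else 0ℚ)
      + fromℕ (n' ∸ m) * μ y + Id allMinus y * Σ[ states m ] μ
  inflow-≡ μ y = begin
      Σ[ states m ] (λ x → μ x * Σ[ upTo n ] (λ i → Id (step n m i x) y))
        ≡⟨ Σ-cong (states m) (λ x → cong (μ x *_) (Σ-draws n' m m≤n' (λ w → Id w y) x)) ⟩
      Σ[ states m ] (λ x → μ x * (sumFin (λ j → Id (setPlus x j) y) + Y * Id x y + Id allMinus y))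
        ≡⟨ Σ-cong (states m) (λ x → trans
             (solve 5 (λ M A Y I Z → M :* (A :+ Y :* I :+ Z) := M :* A :+ Y :* (M :* I) :+ Z :* M) refl
                (μ x) (sumFin (λ j → Id (setPlus x j) y)) Y (Id x y) (Id allMinus y))
             (cong (λ t → t + Y * (μ x * Id x y) + Id allMinus y * μ x) (sym (sumFin-*ˡ (μ x) (λ j → Id (setPlus x j) y))))) ⟩
      Σ[ states m ] (λ x → sumFin (λ j → μ x * Id (setPlus x j) y) + Y * (μ x * Id x y) + Id allMinus y * μ x)
        ≡⟨ Σ-+ (states m) (λ x → sumFin (λ j → μ x * Id (setPlus x j) y) + Y * (μ x * Id x y)) (λ x → Id allMinus y * μ x) ⟩
      Σ[ states m ] (λ x → sumFin (λ j → μ x * Id (setPlus x j) y) + Y * (μ x * Id x y))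
        + Σ[ states m ] (λ x → Id allMinus y * μ x)
        ≡⟨ cong₂ _+_ (trans (Σ-+ (states m) (λ x → sumFin (λ j → μ x * Id (setPlus x j) y)) (λ x → Y * (μ x * Id x y)))
                       (cong₂ _+_ (trans (Σ-sumFin (states m) (λ x j → μ x * Id (setPlus x j) y))
                                         (sumFin-cong (λ j → Σ-*Id-setPlus μ j y)))
                                  (trans (Σ-*ˡ (states m) Y (λ x → μ x * Id x y)) (cong (Y *_) (Σ-*Id y μ)))))
                     (Σ-*ˡ (states m) (Id allMinus y) μ) ⟩
      sumFin (λ j → if lookup y j then μ (setPlus y j) + μ (setMinus y j) else 0ℚ) + Y * μ y + Id allMinus y * Σ[ states m ] μ ∎
    where
    open ≡-Reasoning
    Y : ℚ
    Y = fromℕ (n' ∸ m)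

  πbar-inflow-allMinus : inflow (πbar m) allMinus ≡ fromℕ n * πbar m allMinus
  πbar-inflow-allMinus = begin
      inflow π allMinus
        ≡⟨ inflow-≡ π allMinus ⟩
      sumFin (λ j → if lookup allMinus j then π (setPlus allMinus j) + π (setMinus allMinus j) else 0ℚ)
        + Y * p + Id (allMinus {m}) allMinus * Σ[ states m ] π
        ≡⟨ cong₂ (λ u v → u + Y * p + v)
             (trans (sumFin-cong (λ j → cong (if_then π (setPlus allMinus j) + π (setMinus allMinus j) else 0ℚ)
                                               (numPlus≡0⇒lookup allMinus j (numPlus-allMinus m))))
                    (trans (sumFin-const m 0ℚ) (QP.*-zeroʳ (fromℕ m))))
             (cong₂ _*_ (Id-refl (allMinus {m})) (Σ-πbar m)) ⟩
      0ℚ + Y * p + 1ℚ * 1ℚ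
        ≡⟨ cong (λ t → 0ℚ + Y * p + t) (sym p*[m+1]≡1) ⟩
      0ℚ + Y * p + p * fromℕ (suc m)
        ≡⟨ solve 3 (λ Y p M → con 0ℚ :+ Y :* p :+ p :* M := (Y :+ M) :* p) refl Y p (fromℕ (suc m)) ⟩
      (Y + fromℕ (suc m)) * p
        ≡⟨ cong (_* p) (trans (sym (fromℕ-+ (n' ∸ m) (suc m)))
                        (cong fromℕ (trans (ℕP.+-comm (n' ∸ m) (suc m)) (cong suc (ℕP.m+[n∸m]≡n m≤n'))))) ⟩
      fromℕ n * p ∎
    where
    open ≡-Reasoning
    π : Sign m → ℚ
    π = πbar m
    p : ℚ
    p = π allMinus
    Y : ℚ
    Y = fromℕ (n' ∸ m)
    p*[m+1]≡1 : p * fromℕ (suc m) ≡ 1ℚ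
    p*[m+1]≡1 = trans (cong (λ t → frac 1 (suc m ℕ.* (m C t)) * fromℕ (suc m)) (numPlus-allMinus m))
      (trans (cong (λ t → frac 1 t * fromℕ (suc m)) (ℕP.*-identityʳ (suc m))) (frac*fromℕ 1 m))

  πbar-inflow-suc : ∀ y k → numPlus y ≡ suc k → inflow (πbar m) y ≡ fromℕ n * πbar m y
  πbar-inflow-suc y k eq = begin
      inflow π y
        ≡⟨ inflow-≡ π y ⟩
      sumFin (λ j → if lookup y j then π (setPlus y j) + π (setMinus y j) else 0ℚ) + Y * π y + Id allMinus y * Σ[ states m ] π
        ≡⟨ cong₂ (λ u v → u + Y * π y + v)
             (trans (sumFin-cong neighbours) (sumFin-lookup y (p₊ + p₋)))
             (trans (cong (_* Σ[ states m ] π) (Id-≢ allMinus≢y)) (QP.*-zeroˡ (Σ[ states m ] π))) ⟩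
      fromℕ (numPlus y) * (p₊ + p₋) + Y * π y + 0ℚ
        ≡⟨ cong₂ (λ u v → fromℕ u * (p₊ + p₋) + Y * v + 0ℚ) eq πy≡p₊ ⟩
      fromℕ (suc k) * (p₊ + p₋) + Y * p₊ + 0ℚ
        ≡⟨ solve 5 (λ K a b Y Z → K :* (a :+ b) :+ Y :* a :+ Z := K :* b :+ (K :+ Y) :* a :+ Z) refl
             (fromℕ (suc k)) p₊ p₋ Y 0ℚ ⟩
      fromℕ (suc k) * p₋ + (fromℕ (suc k) + Y) * p₊ + 0ℚ
        ≡⟨ cong (λ t → t + (fromℕ (suc k) + Y) * p₊ + 0ℚ) (πlevel-cross m k k<m) ⟩
      fromℕ (m ∸ k) * p₊ + (fromℕ (suc k) + Y) * p₊ + 0ℚ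
        ≡⟨ solve 4 (λ A B Y p → A :* p :+ (B :+ Y) :* p :+ con 0ℚ := (B :+ A :+ Y) :* p) refl
             (fromℕ (m ∸ k)) (fromℕ (suc k)) Y p₊ ⟩
      (fromℕ (suc k) + fromℕ (m ∸ k) + Y) * p₊
        ≡⟨ cong (_* p₊) (trans (cong (_+ Y) (sym (fromℕ-+ (suc k) (m ∸ k))))
                          (trans (sym (fromℕ-+ (suc k ℕ.+ (m ∸ k)) (n' ∸ m))) (cong fromℕ levels))) ⟩
      fromℕ n * p₊
        ≡⟨ cong (fromℕ n *_) πy≡p₊ ⟨
      fromℕ n * π y ∎
    where
    open ≡-Reasoning
    π : Sign m → ℚ
    π = πbar m
    p₊ : ℚ
    p₊ = πlevel m (suc k)
    p₋ : ℚ
    p₋ = πlevel m k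
    Y : ℚ
    Y = fromℕ (n' ∸ m)
    k<m : suc k ℕ.≤ m
    k<m = subst (ℕ._≤ m) eq (numPlus≤ y)
    πy≡p₊ : π y ≡ p₊
    πy≡p₊ = cong (πlevel m) eq
    allMinus≢y : allMinus ≢ y
    allMinus≢y e = ℕP.0≢1+n (trans (sym (numPlus-allMinus m)) (trans (cong numPlus e) eq))
    neighbours : ∀ j → (if lookup y j then π (setPlus y j) + π (setMinus y j) else 0ℚ) ≡ (if lookup y j then p₊ + p₋ else 0ℚ)
    neighbours j with lookup y j in y[j]
    ... | false = refl
    ... | true  = cong₂ _+_ (trans (cong π (setPlus-lookup y j y[j])) πy≡p₊)
                            (cong (πlevel m) (ℕP.suc-injective (trans (numPlus-setMinus y j y[j]) eq)))
    levels : suc k ℕ.+ (m ∸ k) ℕ.+ (n' ∸ m) ≡ n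
    levels = trans (cong (λ t → suc t ℕ.+ (n' ∸ m)) (ℕP.m+[n∸m]≡n (ℕP.≤-trans (ℕP.n≤1+n k) k<m)))
               (cong suc (ℕP.m+[n∸m]≡n m≤n'))

  πbar-inflow : ∀ y k → numPlus y ≡ k → inflow (πbar m) y ≡ fromℕ n * πbar m y
  πbar-inflow y zero    eq = trans (cong (inflow (πbar m)) y≡)
    (trans πbar-inflow-allMinus (cong (λ t → fromℕ n * πbar m t) (sym y≡)))
    where
    y≡ : y ≡ allMinus
    y≡ = numPlus≡0⇒allMinus y eq
  πbar-inflow y (suc k) eq = πbar-inflow-suc y k eq

  πbar-stationary : ∀ y → Σ[ states m ] (λ x → πbar m x * K x y) ≡ πbar m y
  πbar-stationary y = begin
      Σ[ states m ] (λ x → πbar m x * K x y)   ≡⟨ K-applyᵀ (πbar m) y ⟩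
      r * inflow (πbar m) y                    ≡⟨ cong (r *_) (πbar-inflow y (numPlus y) refl) ⟩
      r * (fromℕ n * πbar m y)                 ≡⟨ QP.*-assoc r (fromℕ n) (πbar m y) ⟨
      r * fromℕ n * πbar m y                   ≡⟨ trans (cong (_* πbar m y) r*n≡1) (QP.*-identityˡ (πbar m y)) ⟩
      πbar m y                                 ∎
    where open ≡-Reasoning

*-fixed⇒≡0 : ∀ p q → p * q ≡ p → q ≢ 1ℚ → p ≡ 0ℚ
*-fixed⇒≡0 p q pq≡p q≢1 = begin
    p                      ≡⟨ QP.*-identityʳ p ⟨
    p * 1ℚ                 ≡⟨ cong (p *_) (QP.*-inverseʳ w) ⟨
    p * (w * 1/ w)         ≡⟨ QP.*-assoc p w (1/ w) ⟨
    p * w * 1/ w           ≡⟨ cong (_* 1/ w) pw≡0 ⟩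
    0ℚ * 1/ w              ≡⟨ QP.*-zeroˡ (1/ w) ⟩
    0ℚ                     ∎
  where
  open ≡-Reasoning
  w : ℚ
  w = q - 1ℚ
  w≢0 : w ≢ 0ℚ
  w≢0 e = q≢1 (trans (sym (QP.+-identityʳ q)) (trans (cong (q +_) (sym (QP.+-inverseˡ 1ℚ)))
            (trans (sym (QP.+-assoc q (- 1ℚ) 1ℚ)) (trans (cong (_+ 1ℚ) e) (QP.+-identityˡ 1ℚ)))))
  instance
    w-nonZero : Q.NonZero w
    w-nonZero = Q.≢-nonZero w≢0
  pw≡0 : p * w ≡ 0ℚ
  pw≡0 = trans (solve 2 (λ p q → p :* (q :- con 1ℚ) := p :* q :- p) refl p q) (trans (cong (_- p) pq≡p) (QP.+-inverseʳ p))

module Uniqueness (n' m : ℕ) (m≤n' : m ℕ.≤ n') where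
  open Kernel n' m

  Stationary : (Sign m → ℚ) → Set
  Stationary μ = ∀ y → Σ[ states m ] (λ x → μ x * K x y) ≡ μ y

  -- the coordinates of μ in the eigenbasis
  μP : (Sign m → ℚ) → Sign m → ℚ
  μP μ S = Σ[ states m ] (λ x → μ x * P x S)

  μP-eigen : ∀ μ → Stationary μ → ∀ S → μP μ S * eigenvalue n (numPlus S) ≡ μP μ S
  μP-eigen μ μK≡μ S = begin
      μP μ S * eigenvalue n (numPlus S)
        ≡⟨ Σ-*ʳ (states m) (eigenvalue n (numPlus S)) (λ x → μ x * P x S) ⟨
      Σ[ states m ] (λ x → μ x * P x S * eigenvalue n (numPlus S))
        ≡⟨ Σ-cong (states m) (λ x → trans (QP.*-assoc (μ x) (P x S) _) (cong (μ x *_) (sym (K⊗P n' m m≤n' x S)))) ⟩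
      Σ[ states m ] (λ x → μ x * (K ⊗ P) x S)
        ≡⟨ Σ-*⊗ μ K P S ⟩
      Σ[ states m ] (λ z → Σ[ states m ] (λ x → μ x * K x z) * P z S)
        ≡⟨ Σ-cong (states m) (λ z → cong (_* P z S) (μK≡μ z)) ⟩
      μP μ S ∎
    where open ≡-Reasoning

  -- only the eigenvalue 1 survives, and its coordinate is the total mass
  μP-stationary : ∀ μ → Stationary μ → Σ[ states m ] μ ≡ 1ℚ → ∀ S k → numPlus S ≡ k → μP μ S ≡ Id S allMinus
  μP-stationary μ μK≡μ Σμ≡1 S zero eq = begin
      μP μ S                                 ≡⟨ cong (μP μ) S≡ ⟩
      μP μ allMinus                          ≡⟨ Σ-cong (states m) (λ x → trans (cong (μ x *_) (P-allMinus x)) (QP.*-identityʳ (μ x))) ⟩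
      Σ[ states m ] μ                        ≡⟨ Σμ≡1 ⟩
      1ℚ                                     ≡⟨ Id-refl (allMinus {m}) ⟨
      Id (allMinus {m}) allMinus             ≡⟨ cong (λ t → Id t allMinus) S≡ ⟨
      Id S allMinus                          ∎
    where
    open ≡-Reasoning
    S≡ : S ≡ allMinus
    S≡ = numPlus≡0⇒allMinus S eq
  μP-stationary μ μK≡μ Σμ≡1 S (suc k) eq =
    trans (*-fixed⇒≡0 (μP μ S) _ (μP-eigen μ μK≡μ S) eigenvalue≢1) (sym (Id-≢ S≢allMinus))
    where
    eigenvalue≢1 : eigenvalue n (numPlus S) ≢ 1ℚ
    eigenvalue≢1 e = ℕP.0≢1+n (trans (sym (eigenvalue-injective n' (numPlus S) 0 (ℕP.≤-trans (numPlus≤ S) m≤n') z≤n e)) eq)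
    S≢allMinus : S ≢ allMinus
    S≢allMinus e = ℕP.0≢1+n (trans (sym (numPlus-allMinus m)) (trans (cong numPlus (sym e)) eq))

  μP-P⁻¹ : ∀ μ y → μ y ≡ Σ[ states m ] (λ S → μP μ S * P⁻¹ S y)
  μP-P⁻¹ μ y = trans (sym (Σ-*Id y μ))
    (trans (Σ-cong (states m) (λ x → cong (μ x *_) (sym (P-P⁻¹ x y)))) (Σ-*⊗ μ P P⁻¹ y))

  stationary-unique : ∀ μ ν → Stationary μ → Stationary ν → Σ[ states m ] μ ≡ 1ℚ → Σ[ states m ] ν ≡ 1ℚ →
    ∀ x → μ x ≡ ν x
  stationary-unique μ ν μK≡μ νK≡ν Σμ≡1 Σν≡1 x = begin
      μ x                                         ≡⟨ μP-P⁻¹ μ x ⟩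
      Σ[ states m ] (λ S → μP μ S * P⁻¹ S x)      ≡⟨ Σ-cong (states m) (λ S → cong (_* P⁻¹ S x)
                                                       (trans (μP-stationary μ μK≡μ Σμ≡1 S (numPlus S) refl)
                                                              (sym (μP-stationary ν νK≡ν Σν≡1 S (numPlus S) refl)))) ⟩
      Σ[ states m ] (λ S → μP ν S * P⁻¹ S x)      ≡⟨ μP-P⁻¹ ν x ⟨
      ν x                                         ∎
    where open ≡-Reasoning

-- Contraction in total variation when m = n − 1

≤-respˡ-≡ : ∀ {x x′ y} → x ≡ x′ → x Q.≤ y → x′ Q.≤ y
≤-respˡ-≡ refl x≤y = x≤y

≤-respʳ-≡ : ∀ {x y y′} → y ≡ y′ → x Q.≤ y → x Q.≤ y′
≤-respʳ-≡ refl x≤y = x≤y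

*-nonNeg : ∀ {p q} → 0ℚ Q.≤ p → 0ℚ Q.≤ q → 0ℚ Q.≤ p * q
*-nonNeg {p} 0≤p 0≤q = ≤-respˡ-≡ (QP.*-zeroʳ p) (QP.*-monoˡ-≤-nonNeg p {{Q.nonNegative 0≤p}} 0≤q)

*-monoʳ-≤-0≤ : ∀ {p q r} → 0ℚ Q.≤ p → q Q.≤ r → p * q Q.≤ p * r
*-monoʳ-≤-0≤ {p} 0≤p q≤r = QP.*-monoˡ-≤-nonNeg p {{Q.nonNegative 0≤p}} q≤r

frac-nonNeg : ∀ a b → 0ℚ Q.≤ frac a b
frac-nonNeg a zero    = QP.≤-refl
frac-nonNeg a (suc b) = QP.nonNegative⁻¹ _ {{QP.normalize-nonNeg a (suc b)}}

fromℕ-nonNeg : ∀ a → 0ℚ Q.≤ fromℕ a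
fromℕ-nonNeg a = frac-nonNeg a 1

p≤q⇒0≤q-p : ∀ {p q} → p Q.≤ q → 0ℚ Q.≤ q - p
p≤q⇒0≤q-p {p} p≤q = ≤-respˡ-≡ (QP.+-inverseʳ p) (QP.+-monoˡ-≤ (- p) p≤q)

maxList-nonNeg : ∀ (L : List ℚ) → 0ℚ Q.≤ maxList L
maxList-nonNeg []      = QP.≤-refl
maxList-nonNeg (x ∷ L) = QP.≤-trans (maxList-nonNeg L) (QP.p≤q⊔p x (maxList L))

module _ {A : Set} (f : A → ℚ) where

  ≤-maxList : ∀ {a} (L : List A) → a ∈ L → f a Q.≤ maxList (map f L)
  ≤-maxList (x ∷ L) (here refl) = QP.p≤p⊔q (f x) _
  ≤-maxList (x ∷ L) (there a∈L) = QP.≤-trans (≤-maxList L a∈L) (QP.p≤q⊔p (f x) _)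

  maxList-≤ : ∀ (L : List A) {c} → 0ℚ Q.≤ c → (∀ a → a ∈ L → f a Q.≤ c) → maxList (map f L) Q.≤ c
  maxList-≤ []      0≤c _ = 0≤c
  maxList-≤ (x ∷ L) 0≤c h = QP.⊔-lub (h x (here refl)) (maxList-≤ L 0≤c (λ a a∈L → h a (there a∈L)))

module _ {A : Set} where

  filter∈subsets : ∀ {P : A → Set} (P? : ∀ x → Dec (P x)) (xs : List A) → filter P? xs ∈ subsets xs
  filter∈subsets P? []       = here refl
  filter∈subsets P? (x ∷ xs) with does (P? x)
  ... | true  = ∈-++⁺ˡ (∈-map⁺ (x ∷_) (filter∈subsets P? xs))
  ... | false = ∈-++⁺ʳ (map (x ∷_) (subsets xs)) (filter∈subsets P? xs)

  length-filter-∷ : ∀ {P : A → Set} (P? : ∀ x → Dec (P x)) x xs → length (filter P? xs) ℕ.≤ length (filter P? (x ∷ xs))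
  length-filter-∷ P? x xs with does (P? x)
  ... | true  = ℕP.n≤1+n _
  ... | false = ℕP.≤-refl

  length-filter-subset : ∀ {P : A → Set} (P? : ∀ x → Dec (P x)) (xs : List A) {B} → B ∈ subsets xs →
    length (filter P? B) ℕ.≤ length (filter P? xs)
  length-filter-subset P? []       (here refl) = z≤n
  length-filter-subset P? (x ∷ xs) B∈ with ∈-++⁻ (map (x ∷_) (subsets xs)) B∈
  ... | inj₂ B∈′ = ℕP.≤-trans (length-filter-subset P? xs B∈′) (length-filter-∷ P? x xs)
  ... | inj₁ B∈′ with ∈-map⁻ (x ∷_) B∈′
  ...   | B′ , B′∈ , refl with does (P? x)
  ...     | true  = s≤s (length-filter-subset P? xs B′∈)
  ...     | false = length-filter-subset P? xs B′∈

  Σ-nonNeg : ∀ (f : A → ℚ) → (∀ x → 0ℚ Q.≤ f x) → (xs : List A) → 0ℚ Q.≤ Σ[ xs ] f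
  Σ-nonNeg f 0≤f []       = QP.≤-refl
  Σ-nonNeg f 0≤f (x ∷ xs) = ≤-respˡ-≡ (QP.+-identityˡ 0ℚ) (QP.+-mono-≤ (0≤f x) (Σ-nonNeg f 0≤f xs))

  Σ-subset-≤ : ∀ (f : A → ℚ) → (∀ x → 0ℚ Q.≤ f x) → (xs : List A) → ∀ {B} → B ∈ subsets xs → Σ[ B ] f Q.≤ Σ[ xs ] f
  Σ-subset-≤ f 0≤f []       (here refl) = QP.≤-refl
  Σ-subset-≤ f 0≤f (x ∷ xs) B∈ with ∈-++⁻ (map (x ∷_) (subsets xs)) B∈
  ... | inj₂ B∈′ = QP.≤-trans (Σ-subset-≤ f 0≤f xs B∈′)
                     (≤-respˡ-≡ (QP.+-identityˡ _) (QP.+-monoˡ-≤ (Σ[ xs ] f) (0≤f x)))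
  ... | inj₁ B∈′ with ∈-map⁻ (x ∷_) B∈′
  ...   | B′ , B′∈ , refl = QP.+-monoʳ-≤ (f x) (Σ-subset-≤ f 0≤f xs B′∈)

Σ-Id-subset : ∀ {m} {B} → B ∈ subsets (states m) → ∀ w → Σ[ B ] (Id w) ≡ 0ℚ ⊎ Σ[ B ] (Id w) ≡ 1ℚ
Σ-Id-subset {m} {B} B∈ w with ≤1 (ℕP.≤-trans (length-filter-subset (w ≟v_) (states m) B∈) (ℕP.≤-reflexive once))
  where
  ≤1 : ∀ {k} → k ℕ.≤ 1 → k ≡ 0 ⊎ k ≡ 1
  ≤1 z≤n       = inj₁ refl
  ≤1 (s≤s z≤n) = inj₂ refl
  once : length (filter (w ≟v_) (states m)) ≡ 1
  once = fromℕ-injective (trans (length-filter-Σ (states m) (w ≟v_))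
    (trans (Σ-cong (states m) (λ y → sym (QP.*-identityʳ (Id w y)))) (Σ-Id* w (λ _ → 1ℚ))))
... | inj₁ e = inj₁ (trans (sym (length-filter-Σ B (w ≟v_))) (cong fromℕ e))
... | inj₂ e = inj₂ (trans (sym (length-filter-Σ B (w ≟v_))) (cong fromℕ e))

∣sumFin∣≤ : ∀ {m} (f : Fin m → ℚ) T → (∀ j → ∣ f j ∣ Q.≤ T) → ∣ sumFin f ∣ Q.≤ fromℕ m * T
∣sumFin∣≤ {zero}  f T h = QP.≤-reflexive (sym (QP.*-zeroˡ T))
∣sumFin∣≤ {suc m} f T h = QP.≤-trans (QP.∣p+q∣≤∣p∣+∣q∣ (f zero) _)
  (≤-respʳ-≡ (trans (solve 2 (λ t l → t :+ l :* t := (con 1ℚ :+ l) :* t) refl T (fromℕ m)) (cong (_* T) (sym (fromℕ-suc m))))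
    (QP.+-mono-≤ (h zero) (∣sumFin∣≤ (λ j → f (suc j)) T (λ j → h (suc j)))))

^ℚ-nonNeg : ∀ {p} → 0ℚ Q.≤ p → ∀ k → 0ℚ Q.≤ p ^ℚ k
^ℚ-nonNeg 0≤p zero    = QP.nonNegative⁻¹ 1ℚ
^ℚ-nonNeg 0≤p (suc k) = *-nonNeg 0≤p (^ℚ-nonNeg 0≤p k)

module Contraction (n' : ℕ) where
  open Kernel n' n'
  open Balance n' n' ℕP.≤-refl using (πbar-stationary)

  π : Sign n' → ℚ
  π = πbar n'

  dist : (Sign n' → ℚ) → ℚ
  dist μ = TV n' μ π

  count : List (Sign n') → Sign n' → ℚ
  count A w = Σ[ A ] (Id w)

  r*n'≡1-r : r * fromℕ n' ≡ 1ℚ - r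
  r*n'≡1-r = begin
      r * fromℕ n'               ≡⟨ solve 2 (λ r x → r :* x := r :* (con 1ℚ :+ x) :- r) refl r (fromℕ n') ⟩
      r * (1ℚ + fromℕ n') - r    ≡⟨ cong (λ t → r * t - r) (fromℕ-suc n') ⟨
      r * fromℕ n - r            ≡⟨ cong (_- r) r*n≡1 ⟩
      1ℚ - r                     ∎
    where open ≡-Reasoning

  0≤r : 0ℚ Q.≤ r
  0≤r = frac-nonNeg 1 n

  0≤1-r : 0ℚ Q.≤ 1ℚ - r
  0≤1-r = ≤-respʳ-≡ r*n'≡1-r (*-nonNeg 0≤r (fromℕ-nonNeg n'))

  Σ-K-over : ∀ A z → Σ[ A ] (K z) ≡ r * Σ[ upTo n ] (λ i → count A (step n n' i z))
  Σ-K-over A z = begin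
      Σ[ A ] (K z)                                               ≡⟨ Σ-cong A (K-entry z) ⟩
      Σ[ A ] (λ y → r * Σ[ upTo n ] (λ i → Id (step n n' i z) y)) ≡⟨ Σ-*ˡ A r _ ⟩
      r * Σ[ A ] (λ y → Σ[ upTo n ] (λ i → Id (step n n' i z) y)) ≡⟨ cong (r *_) (Σ-swap A (upTo n) (λ y i → Id (step n n' i z) y)) ⟩
      r * Σ[ upTo n ] (λ i → count A (step n n' i z))             ∎
    where open ≡-Reasoning

  module OneStep (μ : Sign n' → ℚ) (Σμ≡1 : Σ[ states n' ] μ ≡ 1ℚ) (A : List (Sign n')) where
    δ : Sign n' → ℚ
    δ z = μ z - π z

    δ-preimage : Fin n' → ℚ
    δ-preimage j = Σ[ states n' ] (λ z → δ z * count A (setPlus z j))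

    Σδ≡0 : Σ[ states n' ] δ ≡ 0ℚ
    Σδ≡0 = trans (Σ-minus (states n') μ π) (trans (cong₂ _-_ Σμ≡1 (Σ-πbar n')) (QP.+-inverseʳ 1ℚ))

    δ-step : ∀ z → δ z * Σ[ A ] (K z) ≡ r * sumFin (λ j → δ z * count A (setPlus z j)) + r * count A allMinus * δ z
    δ-step z = begin
        δ z * Σ[ A ] (K z)
          ≡⟨ cong (δ z *_) (trans (Σ-K-over A z) (cong (r *_) (Σ-draws n' n' ℕP.≤-refl (count A) z))) ⟩
        δ z * (r * (sumFin (λ j → count A (setPlus z j)) + fromℕ (n' ∸ n') * count A z + count A allMinus))
          ≡⟨ cong (λ t → δ z * (r * (sumFin (λ j → count A (setPlus z j)) + fromℕ t * count A z + count A allMinus)))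
               (ℕP.n∸n≡0 n') ⟩
        δ z * (r * (sumFin (λ j → count A (setPlus z j)) + 0ℚ * count A z + count A allMinus))
          ≡⟨ solve 5 (λ d r F c c₀ → d :* (r :* (F :+ con 0ℚ :* c :+ c₀)) := r :* (d :* F) :+ r :* c₀ :* d) refl
               (δ z) r (sumFin (λ j → count A (setPlus z j))) (count A z) (count A allMinus) ⟩
        r * (δ z * sumFin (λ j → count A (setPlus z j))) + r * count A allMinus * δ z
          ≡⟨ cong (λ t → r * t + r * count A allMinus * δ z) (sumFin-*ˡ (δ z) (λ j → count A (setPlus z j))) ⟨
        r * sumFin (λ j → δ z * count A (setPlus z j)) + r * count A allMinus * δ z ∎
      where open ≡-Reasoning

    -- with no idle draws, the resets contribute equally to μ K and π K
    μK-πK : Σ[ A ] (λ y → Σ[ states n' ] (λ z → μ z * K z y)) - Σ[ A ] (λ y → Σ[ states n' ] (λ z → π z * K z y))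
            ≡ r * sumFin δ-preimage
    μK-πK = begin
        Σ[ A ] (λ y → Σ[ states n' ] (λ z → μ z * K z y)) - Σ[ A ] (λ y → Σ[ states n' ] (λ z → π z * K z y))
          ≡⟨ Σ-minus A (λ y → Σ[ states n' ] (λ z → μ z * K z y)) (λ y → Σ[ states n' ] (λ z → π z * K z y)) ⟨
        Σ[ A ] (λ y → Σ[ states n' ] (λ z → μ z * K z y) - Σ[ states n' ] (λ z → π z * K z y))
          ≡⟨ Σ-cong A (λ y → trans (sym (Σ-minus (states n') (λ z → μ z * K z y) (λ z → π z * K z y)))
               (Σ-cong (states n') (λ z → solve 3 (λ a b k → a :* k :- b :* k := (a :- b) :* k) refl (μ z) (π z) (K z y)))) ⟩
        Σ[ A ] (λ y → Σ[ states n' ] (λ z → δ z * K z y))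
          ≡⟨ Σ-swap A (states n') (λ y z → δ z * K z y) ⟩
        Σ[ states n' ] (λ z → Σ[ A ] (λ y → δ z * K z y))
          ≡⟨ Σ-cong (states n') (λ z → trans (Σ-*ˡ A (δ z) (K z)) (δ-step z)) ⟩
        Σ[ states n' ] (λ z → r * sumFin (λ j → δ z * count A (setPlus z j)) + r * count A allMinus * δ z)
          ≡⟨ Σ-+ (states n') (λ z → r * sumFin (λ j → δ z * count A (setPlus z j))) (λ z → r * count A allMinus * δ z) ⟩
        Σ[ states n' ] (λ z → r * sumFin (λ j → δ z * count A (setPlus z j)))
          + Σ[ states n' ] (λ z → r * count A allMinus * δ z)
          ≡⟨ cong₂ _+_ (trans (Σ-*ˡ (states n') r _) (cong (r *_) (Σ-sumFin (states n') (λ z j → δ z * count A (setPlus z j)))))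
                       (trans (Σ-*ˡ (states n') (r * count A allMinus) δ)
                              (trans (cong (r * count A allMinus *_) Σδ≡0) (QP.*-zeroʳ (r * count A allMinus)))) ⟩
        r * sumFin δ-preimage + 0ℚ
          ≡⟨ QP.+-identityʳ _ ⟩
        r * sumFin δ-preimage ∎
      where open ≡-Reasoning

    module _ (A∈ : A ∈ subsets (states n')) where

      ∣δ-preimage∣≤ : ∀ j → ∣ δ-preimage j ∣ Q.≤ dist μ
      ∣δ-preimage∣≤ j = ≤-respˡ-≡ (cong ∣_∣ (sym preimage-≡))
        (≤-maxList (λ B → ∣ Σ[ B ] μ - Σ[ B ] π ∣) (subsets (states n')) (filter∈subsets inA? (states n')))
        where
        inA? : ∀ z → Dec (count A (setPlus z j) ≡ 1ℚ)
        inA? = λ z → count A (setPlus z j) QP.≟ 1ℚ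
        select : ∀ q → q ≡ 0ℚ ⊎ q ≡ 1ℚ → ∀ a b →
          (if does (q QP.≟ 1ℚ) then a else 0ℚ) - (if does (q QP.≟ 1ℚ) then b else 0ℚ) ≡ (a - b) * q
        select q (inj₁ refl) a b = solve 2 (λ a b → con 0ℚ :- con 0ℚ := (a :- b) :* con 0ℚ) refl a b
        select q (inj₂ refl) a b = sym (QP.*-identityʳ (a - b))
        preimage-≡ : δ-preimage j ≡ Σ[ filter inA? (states n') ] μ - Σ[ filter inA? (states n') ] π
        preimage-≡ = sym (trans (cong₂ _-_ (Σ-filter (states n') inA? μ) (Σ-filter (states n') inA? π))
          (trans (sym (Σ-minus (states n') (λ z → if does (inA? z) then μ z else 0ℚ) (λ z → if does (inA? z) then π z else 0ℚ)))
                 (Σ-cong (states n') (λ z → select (count A (setPlus z j)) (Σ-Id-subset A∈ (setPlus z j)) (μ z) (π z)))))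

      ∣μK-πK∣≤ : ∣ r * sumFin δ-preimage ∣ Q.≤ (1ℚ - r) * dist μ
      ∣μK-πK∣≤ = begin
          ∣ r * sumFin δ-preimage ∣            ≡⟨ QP.∣p*q∣≡∣p∣*∣q∣ r (sumFin δ-preimage) ⟩
          ∣ r ∣ * ∣ sumFin δ-preimage ∣        ≡⟨ cong (_* ∣ sumFin δ-preimage ∣) (QP.0≤p⇒∣p∣≡p 0≤r) ⟩
          r * ∣ sumFin δ-preimage ∣            ≤⟨ *-monoʳ-≤-0≤ 0≤r (∣sumFin∣≤ δ-preimage (dist μ) ∣δ-preimage∣≤) ⟩
          r * (fromℕ n' * dist μ)              ≡⟨ QP.*-assoc r (fromℕ n') (dist μ) ⟨
          r * fromℕ n' * dist μ                ≡⟨ cong (_* dist μ) r*n'≡1-r ⟩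
          (1ℚ - r) * dist μ                    ∎
        where open QP.≤-Reasoning

  Σ-Kpower : ∀ l x → Σ[ states n' ] ((K ^[ l ]) x) ≡ 1ℚ
  Σ-Kpower zero    x = trans (Σ-cong (states n') (λ y → sym (QP.*-identityʳ (Id x y)))) (Σ-Id* x (λ _ → 1ℚ))
  Σ-Kpower (suc l) x = begin
      Σ[ states n' ] (λ y → Σ[ states n' ] (λ z → Kˡ x z * K z y))
        ≡⟨ Σ-swap (states n') (states n') (λ y z → Kˡ x z * K z y) ⟩
      Σ[ states n' ] (λ z → Σ[ states n' ] (λ y → Kˡ x z * K z y))
        ≡⟨ Σ-cong (states n') (λ z → trans (Σ-*ˡ (states n') (Kˡ x z) (K z))
                                    (trans (cong (Kˡ x z *_) (Σ-K z)) (QP.*-identityʳ (Kˡ x z)))) ⟩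
      Σ[ states n' ] (Kˡ x)
        ≡⟨ Σ-Kpower l x ⟩
      1ℚ ∎
    where
    open ≡-Reasoning
    Kˡ : Mat n'
    Kˡ = K ^[ l ]

  dist-step : ∀ l x → dist ((K ^[ suc l ]) x) Q.≤ (1ℚ - r) * dist ((K ^[ l ]) x)
  dist-step l x = maxList-≤ (λ B → ∣ Σ[ B ] ((K ^[ suc l ]) x) - Σ[ B ] π ∣) (subsets (states n'))
    (*-nonNeg 0≤1-r (maxList-nonNeg (map (λ B → ∣ Σ[ B ] ((K ^[ l ]) x) - Σ[ B ] π ∣) (subsets (states n')))))
    (λ A A∈ → ≤-respˡ-≡ (cong ∣_∣ (sym (trans (cong (λ t → Σ[ A ] ((K ^[ suc l ]) x) - t) (Σ-cong A (λ y → sym (πbar-stationary y))))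
                                                  (OneStep.μK-πK ((K ^[ l ]) x) (Σ-Kpower l x) A))))
                (OneStep.∣μK-πK∣≤ ((K ^[ l ]) x) (Σ-Kpower l x) A A∈))

  dist-start : ∀ x → dist (Id x) Q.≤ 1ℚ
  dist-start x = maxList-≤ (λ B → ∣ Σ[ B ] (Id x) - Σ[ B ] π ∣) (subsets (states n')) (QP.nonNegative⁻¹ 1ℚ)
    (λ A A∈ → ∣0or1-s∣≤1 (Σ-Id-subset A∈ x) (Σ-nonNeg π 0≤π A) (≤-respʳ-≡ (Σ-πbar n') (Σ-subset-≤ π 0≤π (states n') A∈)))
    where
    0≤π : ∀ y → 0ℚ Q.≤ π y
    0≤π y = frac-nonNeg 1 (suc n' ℕ.* (n' C numPlus y))
    ∣0or1-s∣≤1 : ∀ {c s} → c ≡ 0ℚ ⊎ c ≡ 1ℚ → 0ℚ Q.≤ s → s Q.≤ 1ℚ → ∣ c - s ∣ Q.≤ 1ℚ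
    ∣0or1-s∣≤1 {s = s} (inj₁ refl) 0≤s s≤1 =
      ≤-respˡ-≡ (sym (trans (cong ∣_∣ (QP.+-identityˡ (- s))) (trans (QP.∣-p∣≡∣p∣ s) (QP.0≤p⇒∣p∣≡p 0≤s)))) s≤1
    ∣0or1-s∣≤1 {s = s} (inj₂ refl) 0≤s s≤1 = ≤-respˡ-≡ (sym (QP.0≤p⇒∣p∣≡p (p≤q⇒0≤q-p s≤1)))
      (≤-respʳ-≡ (QP.+-identityʳ 1ℚ) (QP.+-monoʳ-≤ 1ℚ (QP.neg-antimono-≤ 0≤s)))

  dist-≤ : ∀ x l → dist ((K ^[ l ]) x) Q.≤ (1ℚ - r) ^ℚ l
  dist-≤ x zero    = dist-start x
  dist-≤ x (suc l) = QP.≤-trans (dist-step l x) (*-monoʳ-≤-0≤ 0≤1-r (dist-≤ x l))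

-- Sharpness

fromℕ-mono-≤ : ∀ {a b} → a ℕ.≤ b → fromℕ a Q.≤ fromℕ b
fromℕ-mono-≤ {a} {b} a≤b =
  ≤-respʳ-≡ (trans (sym (fromℕ-+ a (b ∸ a))) (cong fromℕ (ℕP.m+[n∸m]≡n a≤b)))
    (≤-respˡ-≡ (QP.+-identityʳ (fromℕ a)) (QP.+-monoʳ-≤ (fromℕ a) (fromℕ-nonNeg (b ∸ a))))

^ℚ-≤1 : ∀ {p} → 0ℚ Q.≤ p → p Q.≤ 1ℚ → ∀ k → p ^ℚ k Q.≤ 1ℚ
^ℚ-≤1 0≤p p≤1 zero    = QP.≤-refl
^ℚ-≤1 0≤p p≤1 (suc k) = QP.≤-trans (*-monoʳ-≤-0≤ 0≤p (^ℚ-≤1 0≤p p≤1 k)) (≤-respˡ-≡ (sym (QP.*-identityʳ _)) p≤1)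

^ℚ-mono-≤ : ∀ {p q} → 0ℚ Q.≤ p → p Q.≤ q → ∀ k → p ^ℚ k Q.≤ q ^ℚ k
^ℚ-mono-≤ 0≤p p≤q zero    = QP.≤-refl
^ℚ-mono-≤ {p} 0≤p p≤q (suc k) =
  QP.≤-trans (QP.*-monoʳ-≤-nonNeg (p ^ℚ k) {{Q.nonNegative (^ℚ-nonNeg 0≤p k)}} p≤q)
             (*-monoʳ-≤-0≤ (QP.≤-trans 0≤p p≤q) (^ℚ-mono-≤ 0≤p p≤q k))

^ℚ-+ : ∀ p j k → p ^ℚ (j ℕ.+ k) ≡ p ^ℚ j * p ^ℚ k
^ℚ-+ p zero    k = sym (QP.*-identityˡ _)
^ℚ-+ p (suc j) k = trans (cong (p *_) (^ℚ-+ p j k)) (sym (QP.*-assoc p _ _))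

^ℚ-antitone : ∀ {p} → 0ℚ Q.≤ p → p Q.≤ 1ℚ → ∀ {j k} → j ℕ.≤ k → p ^ℚ k Q.≤ p ^ℚ j
^ℚ-antitone {p} 0≤p p≤1 {j} {k} j≤k =
  ≤-respˡ-≡ (trans (sym (^ℚ-+ p j (k ∸ j))) (cong (p ^ℚ_) (ℕP.m+[n∸m]≡n j≤k)))
    (≤-respʳ-≡ (QP.*-identityʳ _) (*-monoʳ-≤-0≤ (^ℚ-nonNeg 0≤p j) (^ℚ-≤1 0≤p p≤1 (k ∸ j))))

bernoulli : ∀ {a} → 0ℚ Q.≤ a → a Q.≤ 1ℚ → ∀ q → 1ℚ - fromℕ q * a Q.≤ (1ℚ - a) ^ℚ q
bernoulli {a} 0≤a a≤1 zero    = QP.≤-reflexive (trans (cong (λ t → 1ℚ - t) (QP.*-zeroˡ a)) (QP.+-identityʳ 1ℚ))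
bernoulli {a} 0≤a a≤1 (suc q) = QP.≤-trans one-step (*-monoʳ-≤-0≤ (p≤q⇒0≤q-p a≤1) (bernoulli 0≤a a≤1 q))
  where
  -- the two sides differ by q a² ≥ 0
  one-step : 1ℚ - fromℕ (suc q) * a Q.≤ (1ℚ - a) * (1ℚ - fromℕ q * a)
  one-step = ≤-respʳ-≡ (trans (cong (λ t → 1ℚ - t * a + fromℕ q * (a * a)) (fromℕ-suc q))
                         (solve 2 (λ a Q → con 1ℚ :- (con 1ℚ :+ Q) :* a :+ Q :* (a :* a) := (con 1ℚ :- a) :* (con 1ℚ :- Q :* a))
                            refl a (fromℕ q)))
    (≤-respˡ-≡ (QP.+-identityʳ _) (QP.+-monoʳ-≤ (1ℚ - fromℕ (suc q) * a) (*-nonNeg (fromℕ-nonNeg q) (*-nonNeg 0≤a 0≤a))))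

∃-quarter : ∀ n → ∃ λ q → n ℕ.≤ 4 ℕ.* q × 4 ℕ.* q ℕ.≤ n ℕ.+ 3
∃-quarter zero = 0 , z≤n , z≤n
∃-quarter (suc n) with ∃-quarter n
... | q , n≤4q , 4q≤n+3 with suc n ℕ.≤? 4 ℕ.* q
...   | yes n<4q = q , n<4q , ℕP.≤-trans 4q≤n+3 (ℕP.n≤1+n _)
...   | no  n≮4q = suc q , ℕP.≤-trans (s≤s (ℕP.≤-reflexive n≡4q)) (ℕP.≤-trans (ℕP.m≤n+m _ 3) (ℕP.≤-reflexive 3+[1+4q]≡4[1+q]))
                         , ℕP.≤-reflexive (trans (ℕP.*-suc 4 q) (trans (cong (4 ℕ.+_) (sym n≡4q)) (trans (ℕP.+-comm 4 n) (ℕP.+-suc n 3))))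
  where
  n≡4q : n ≡ 4 ℕ.* q
  n≡4q = ℕP.≤-antisym n≤4q (ℕP.≮⇒≥ n≮4q)
  3+[1+4q]≡4[1+q] : 3 ℕ.+ suc (4 ℕ.* q) ≡ 4 ℕ.* suc q
  3+[1+4q]≡4[1+q] = trans (ℕP.+-suc 3 (4 ℕ.* q)) (sym (ℕP.*-suc 4 q))

-- With 4q ∈ [n, n + 3], Bernoulli gives (1 - 2/n)^q ≥ 1 - 2q/n ≥ 1/4.
[1-2/n]^n≥1/256 : ∀ k → 6 ℕ.≤ suc (suc k) → frac 1 256 Q.≤ frac k (suc (suc k)) ^ℚ suc (suc k)
[1-2/n]^n≥1/256 k 6≤n = begin
    frac 1 256                 ≤⟨ ^ℚ-mono-≤ (frac-nonNeg 1 4) quarter-bound 4 ⟩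
    (β ^ℚ q) ^ℚ 4              ≡⟨ power-4q ⟨
    β ^ℚ (4 ℕ.* q)             ≤⟨ ^ℚ-antitone (frac-nonNeg k n) β≤1 n≤4q ⟩
    β ^ℚ n                     ∎
  where
  open QP.≤-Reasoning
  n : ℕ
  n = suc (suc k)
  r : ℚ
  r = frac 1 n
  a : ℚ
  a = fromℕ 2 * r
  β : ℚ
  β = frac k n
  q : ℕ
  q = proj₁ (∃-quarter n)
  n≤4q : n ℕ.≤ 4 ℕ.* q
  n≤4q = proj₁ (proj₂ (∃-quarter n))
  4q≤n+3 : 4 ℕ.* q ℕ.≤ n ℕ.+ 3
  4q≤n+3 = proj₂ (proj₂ (∃-quarter n))

  n*r≡1 : fromℕ n * r ≡ 1ℚ
  n*r≡1 = trans (QP.*-comm (fromℕ n) r) (frac*fromℕ 1 (suc k))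

  β≡1-a : β ≡ 1ℚ - a
  β≡1-a = begin-equality
      frac k n                               ≡⟨ frac≡fromℕ*frac1 k n ⟩
      fromℕ k * r                            ≡⟨ solve 3 (λ K T r → K :* r := (K :+ T) :* r :- T :* r) refl (fromℕ k) (fromℕ 2) r ⟩
      (fromℕ k + fromℕ 2) * r - a            ≡⟨ cong (λ t → t * r - a) (trans (sym (fromℕ-+ k 2)) (cong fromℕ (ℕP.+-comm k 2))) ⟩
      fromℕ n * r - a                        ≡⟨ cong (_- a) n*r≡1 ⟩
      1ℚ - a                                 ∎

  0≤a : 0ℚ Q.≤ a
  0≤a = *-nonNeg (fromℕ-nonNeg 2) (frac-nonNeg 1 n)

  a≤1 : a Q.≤ 1ℚ
  a≤1 = ≤-respʳ-≡ n*r≡1 (QP.*-monoʳ-≤-nonNeg r {{Q.nonNegative (frac-nonNeg 1 n)}} (fromℕ-mono-≤ {2} {n} (s≤s (s≤s z≤n))))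

  β≤1 : β Q.≤ 1ℚ
  β≤1 = ≤-respˡ-≡ (sym β≡1-a) (≤-respʳ-≡ (QP.+-identityʳ 1ℚ) (QP.+-monoʳ-≤ 1ℚ (QP.neg-antimono-≤ 0≤a)))

  8q≤3n : 4 ℕ.* (2 ℕ.* q) ℕ.≤ 3 ℕ.* n
  8q≤3n = ℕP.≤-trans (ℕP.≤-reflexive (trans (sym (ℕP.*-assoc 4 2 q)) (ℕP.*-assoc 2 4 q)))
          (ℕP.≤-trans (ℕP.*-monoʳ-≤ 2 4q≤n+3)
          (ℕP.≤-trans (ℕP.≤-reflexive (ℕP.*-distribˡ-+ 2 n 3))
          (ℕP.≤-trans (ℕP.+-monoʳ-≤ (2 ℕ.* n) 6≤n) (ℕP.≤-reflexive (ℕP.+-comm (2 ℕ.* n) n)))))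

  qa≤3/4 : fromℕ q * a Q.≤ frac 1 4 * fromℕ 3
  qa≤3/4 = begin
      fromℕ q * a                                   ≡⟨ trans (sym (QP.*-identityˡ _)) (cong (_* (fromℕ q * a)) (sym (frac*fromℕ 1 3))) ⟩
      frac 1 4 * fromℕ 4 * (fromℕ q * a)            ≡⟨ solve 5 (λ u F Q T r → u :* F :* (Q :* (T :* r)) := u :* (F :* (T :* Q) :* r)) refl
                                                          (frac 1 4) (fromℕ 4) (fromℕ q) (fromℕ 2) r ⟩
      frac 1 4 * (fromℕ 4 * (fromℕ 2 * fromℕ q) * r) ≡⟨ cong (λ t → frac 1 4 * (t * r))
                                                          (trans (cong (fromℕ 4 *_) (sym (fromℕ-* 2 q))) (sym (fromℕ-* 4 (2 ℕ.* q)))) ⟩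
      frac 1 4 * (fromℕ (4 ℕ.* (2 ℕ.* q)) * r)      ≤⟨ *-monoʳ-≤-0≤ (frac-nonNeg 1 4)
                                                          (QP.*-monoʳ-≤-nonNeg r {{Q.nonNegative (frac-nonNeg 1 n)}} (fromℕ-mono-≤ 8q≤3n)) ⟩
      frac 1 4 * (fromℕ (3 ℕ.* n) * r)              ≡⟨ cong (frac 1 4 *_) (trans (cong (_* r) (fromℕ-* 3 n))
                                                          (trans (QP.*-assoc (fromℕ 3) (fromℕ n) r) (trans (cong (fromℕ 3 *_) n*r≡1) (QP.*-identityʳ (fromℕ 3))))) ⟩
      frac 1 4 * fromℕ 3                            ∎

  quarter-bound : frac 1 4 Q.≤ β ^ℚ q
  quarter-bound = QP.≤-trans (QP.+-monoʳ-≤ 1ℚ (QP.neg-antimono-≤ qa≤3/4))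
    (≤-respʳ-≡ (cong (_^ℚ q) (sym β≡1-a)) (bernoulli 0≤a a≤1 q))

  power-4q : β ^ℚ (4 ℕ.* q) ≡ (β ^ℚ q) ^ℚ 4
  power-4q = trans (^ℚ-+ β q _) (cong (β ^ℚ q *_) (trans (^ℚ-+ β q _) (cong (β ^ℚ q *_) (trans (^ℚ-+ β q _)
               (cong (β ^ℚ q *_) (^ℚ-+ β q 0))))))

-- h = P(·, S₁) is the centred indicator of B = {first coordinate −}, an eigenvector for (n − 2)/n.
module Sharpness (k : ℕ) where
  open Kernel (suc k) (suc k)
  open Balance (suc k) (suc k) ℕP.≤-refl using (πbar-stationary)
  open Contraction (suc k) using (π; dist; Σ-Kpower)

  S₁ : Sign (suc k)
  S₁ = true ∷ allMinus

  h : Sign (suc k) → ℚ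
  h y = P y S₁

  β : ℚ
  β = eigenvalue n (numPlus S₁)

  half : ℚ
  half = frac 1 2

  β≡k/n : β ≡ frac k n
  β≡k/n = cong (λ j → eigenvalue n (suc j)) (numPlus-allMinus k)

  h-head : ∀ b (y : Sign k) → h (b ∷ y) ≡ g b true - half
  h-head b y = trans (P-entry (b ∷ y) S₁)
    (cong₂ _-_ (trans (cong (g b true *_) (G-allMinusʳ y)) (QP.*-identityʳ (g b true)))
               (cong (λ j → offset (suc j)) (numPlus-allMinus k)))

  Σ-*K-h : ∀ (μ : Sign (suc k) → ℚ) →
    Σ[ states (suc k) ] (λ y → Σ[ states (suc k) ] (λ z → μ z * K z y) * h y) ≡ Σ[ states (suc k) ] (λ z → μ z * h z) * β
  Σ-*K-h μ = begin
      Σ[ st ] (λ y → Σ[ st ] (λ z → μ z * K z y) * h y)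
        ≡⟨ Σ-*⊗ μ K P S₁ ⟨
      Σ[ st ] (λ z → μ z * (K ⊗ P) z S₁)
        ≡⟨ Σ-cong st (λ z → trans (cong (μ z *_) (K⊗P (suc k) (suc k) ℕP.≤-refl z S₁)) (sym (QP.*-assoc (μ z) (h z) β))) ⟩
      Σ[ st ] (λ z → μ z * h z * β)
        ≡⟨ Σ-*ʳ st β (λ z → μ z * h z) ⟩
      Σ[ st ] (λ z → μ z * h z) * β ∎
    where
    open ≡-Reasoning
    st : List (Sign (suc k))
    st = states (suc k)

  Σ-Kpower-h : ∀ l x → Σ[ states (suc k) ] (λ y → (K ^[ l ]) x y * h y) ≡ β ^ℚ l * h x
  Σ-Kpower-h zero    x = trans (Σ-Id* x h) (sym (QP.*-identityˡ (h x)))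
  Σ-Kpower-h (suc l) x = trans (Σ-*K-h ((K ^[ l ]) x))
    (trans (cong (_* β) (Σ-Kpower-h l x)) (solve 3 (λ a b c → a :* b :* c := c :* a :* b) refl (β ^ℚ l) (h x) β))

  Σ-π-h : Σ[ states (suc k) ] (λ y → π y * h y) ≡ 0ℚ
  Σ-π-h = *-fixed⇒≡0 _ β
    (sym (trans (Σ-cong (states (suc k)) (λ y → cong (_* h y) (sym (πbar-stationary y)))) (Σ-*K-h π)))
    (λ β≡1 → ℕP.0≢1+n (sym (eigenvalue-injective (suc k) 1 0 (s≤s z≤n) z≤n (trans (sym β≡k/n) β≡1))))

  first-minus? : ∀ (y : Sign (suc k)) → Dec (lookup y zero ≡ false)
  first-minus? y = lookup y zero BP.≟ false

  B : List (Sign (suc k))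
  B = filter first-minus? (states (suc k))

  Σ-B : ∀ (μ : Sign (suc k) → ℚ) → Σ[ B ] μ ≡ Σ[ states (suc k) ] (λ y → μ y * h y) + half * Σ[ states (suc k) ] μ
  Σ-B μ = trans (Σ-filter (states (suc k)) first-minus? μ) (trans (Σ-cong (states (suc k)) indicator)
    (trans (Σ-+ (states (suc k)) (λ y → μ y * h y) (λ y → half * μ y))
           (cong (Σ[ states (suc k) ] (λ y → μ y * h y) +_) (Σ-*ˡ (states (suc k)) half μ))))
    where
    indicator : ∀ y → (if does (first-minus? y) then μ y else 0ℚ) ≡ μ y * h y + half * μ y
    indicator (true ∷ y)  = trans (solve 1 (λ u → con 0ℚ := u :* (con 0ℚ :- con half) :+ con half :* u) refl (μ (true ∷ y)))
                              (cong (λ t → μ (true ∷ y) * t + half * μ (true ∷ y)) (sym (h-head true y)))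
    indicator (false ∷ y) = trans (solve 1 (λ u → u := u :* (con 1ℚ :- con half) :+ con half :* u) refl (μ (false ∷ y)))
                              (cong (λ t → μ (false ∷ y) * t + half * μ (false ∷ y)) (sym (h-head false y)))

  ∣h∣ : ∀ x → ∣ h x ∣ ≡ half
  ∣h∣ (true ∷ y)  = cong ∣_∣ (h-head true y)
  ∣h∣ (false ∷ y) = cong ∣_∣ (h-head false y)

  dist-≥ : ∀ l x → β ^ℚ l * half Q.≤ dist ((K ^[ l ]) x)
  dist-≥ l x = ≤-respˡ-≡ gap-at-B
    (≤-maxList (λ A → ∣ Σ[ A ] ((K ^[ l ]) x) - Σ[ A ] π ∣) (subsets (states (suc k))) (filter∈subsets first-minus? (states (suc k))))
    where
    open ≡-Reasoning
    μ : Sign (suc k) → ℚ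
    μ = (K ^[ l ]) x
    st : List (Sign (suc k))
    st = states (suc k)
    gap-at-B : ∣ Σ[ B ] μ - Σ[ B ] π ∣ ≡ β ^ℚ l * half
    gap-at-B = begin
        ∣ Σ[ B ] μ - Σ[ B ] π ∣
          ≡⟨ cong₂ (λ u v → ∣ u - v ∣) (Σ-B μ) (Σ-B π) ⟩
        ∣ (Σ[ st ] (λ y → μ y * h y) + half * Σ[ st ] μ) - (Σ[ st ] (λ y → π y * h y) + half * Σ[ st ] π) ∣
          ≡⟨ cong₂ (λ u v → ∣ (u + half * Σ[ st ] μ) - (v + half * Σ[ st ] π) ∣) (Σ-Kpower-h l x) Σ-π-h ⟩
        ∣ (β ^ℚ l * h x + half * Σ[ st ] μ) - (0ℚ + half * Σ[ st ] π) ∣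
          ≡⟨ cong₂ (λ u v → ∣ (β ^ℚ l * h x + half * u) - (0ℚ + half * v) ∣) (Σ-Kpower l x) (Σ-πbar (suc k)) ⟩
        ∣ (β ^ℚ l * h x + half * 1ℚ) - (0ℚ + half * 1ℚ) ∣
          ≡⟨ cong ∣_∣ (solve 2 (λ a H → (a :+ H :* con 1ℚ) :- (con 0ℚ :+ H :* con 1ℚ) := a) refl (β ^ℚ l * h x) half) ⟩
        ∣ β ^ℚ l * h x ∣
          ≡⟨ QP.∣p*q∣≡∣p∣*∣q∣ (β ^ℚ l) (h x) ⟩
        ∣ β ^ℚ l ∣ * ∣ h x ∣
          ≡⟨ cong₂ _*_ (QP.0≤p⇒∣p∣≡p (^ℚ-nonNeg (≤-respʳ-≡ (sym β≡k/n) (frac-nonNeg k n)) l)) (∣h∣ x) ⟩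
        β ^ℚ l * half ∎

  dist-at-n≥1/512 : 6 ℕ.≤ n → ∀ x → frac 1 512 Q.≤ dist ((K ^[ n ]) x)
  dist-at-n≥1/512 6≤n x = QP.≤-trans
    (≤-respʳ-≡ (cong (λ t → t ^ℚ n * half) (sym β≡k/n))
      (QP.*-monoʳ-≤-nonNeg half {{Q.nonNegative (frac-nonNeg 1 2)}} ([1-2/n]^n≥1/256 k 6≤n)))
    (dist-≥ n x)

proposition5p7 :
    ((n m : ℕ) → 2 ℕ.≤ n → 1 ℕ.≤ m → m ℕ.≤ n ∸ 1 →
      (Σ (Mat m) λ P → Σ (Mat m) λ P⁻¹ → Σ (Sign m → ℚ) λ d →
          (∀ x y → (P⁻¹ ⊗ P) x y ≡ Id x y)
        × (∀ x y → (P ⊗ P⁻¹) x y ≡ Id x y)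
        × (∀ x y → (Kstar n m ⊗ P) x y ≡ (P ⊗ diag d) x y)
        × (mult m d 1ℚ ≡ 1)
        × (∀ j → 1 ℕ.≤ j → j ℕ.≤ m → mult m d (frac (n ∸ j ∸ 1) n) ≡ m C j))
      × ((Σ[ states m ] (πbar m) ≡ 1ℚ)
        × (∀ y → (Σ[ states m ] λ x → πbar m x * Kstar n m x y) ≡ πbar m y)
        × (∀ (μ : Sign m → ℚ) → (∀ x → 0ℚ Q.≤ μ x) → Σ[ states m ] μ ≡ 1ℚ
            → (∀ y → (Σ[ states m ] λ x → μ x * Kstar n m x y) ≡ μ y)
            → ∀ x → μ x ≡ πbar m x)))
  × ((n : ℕ) → 2 ℕ.≤ n → (x : Sign (n ∸ 1)) → (l : ℕ) →
      TV (n ∸ 1) ((Kstar n (n ∸ 1) ^[ l ]) x) (πbar (n ∸ 1)) Q.≤ (1ℚ - frac 1 n) ^ℚ l)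
  × (Σ ℚ λ θ → (0ℚ Q.< θ) × (θ Q.< 1ℚ) × ∃ λ (N : ℕ) → ∀ n → N ℕ.≤ n → 2 ℕ.≤ n →
      (x : Sign (n ∸ 1)) → θ Q.≤ TV (n ∸ 1) ((Kstar n (n ∸ 1) ^[ n ]) x) (πbar (n ∸ 1)))
proposition5p7 =
    (λ where
      (suc (suc k)) m (s≤s (s≤s _)) _ m≤n' →
        let open Balance (suc k) m m≤n' using (πbar-stationary)
            open Uniqueness (suc k) m m≤n' using (stationary-unique)
            d : Sign m → ℚ
            d S = eigenvalue (suc (suc k)) (numPlus S)
        in (P , P⁻¹ , d , P⁻¹-P , P-P⁻¹
             , (λ x y → trans (K⊗P (suc k) m m≤n' x y) (sym (Σ-*diag P d x y)))
             , mult-eigenvalue (suc k) m m≤n' 0 z≤n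
             , (λ { (suc j) _ j<m → mult-eigenvalue (suc k) m m≤n' (suc j) (ℕP.≤-trans j<m m≤n') }))
         , (Σ-πbar m , πbar-stationary
            , λ μ _ Σμ≡1 μK≡μ → stationary-unique μ (πbar m) μK≡μ πbar-stationary Σμ≡1 (Σ-πbar m)))
  , (λ where
      (suc (suc k)) (s≤s (s≤s _)) x l → Contraction.dist-≤ (suc k) x l)
  , (frac 1 512 , toWitness {a? = 0ℚ QP.<? frac 1 512} tt , toWitness {a? = frac 1 512 QP.<? 1ℚ} tt , 6 ,
     λ where
       (suc (suc k)) 6≤n (s≤s (s≤s _)) x → Sharpness.dist-at-n≥1/512 k 6≤n x)
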